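{- Let the polynomials $P_k(x)$ be defined by $P_0:=0$, $P_1:=1$ and, for $k\ge2$, $$P_k(x):=-\frac{1}{(2k-1)(k-1)}\sum_{i=1}^{k-1}\left(6x\binom{2k}{2i}(2^{2i-1}-1)+\binom{2k}{2i+2}(2^{2i+1}-1)-2^{2i}\binom{2k}{2i+1}+\binom{2k}{2i}\right)P_{k-i}(x).$$ Then for $k\ge2$ the polynomial $P_k(x)$ has integer coefficients, and if $\ell>3$ is prime then $$P_{\frac{\ell+1}2}(x)\equiv\frac{\ell+1}2\left(1+(1-24x)^{\frac{\ell-1}2}\right)\pmod{\ell}$$ (coefficientwise). -}

module Defs where

open import Data.Nat as ℕ using (ℕ; zero; suc; _≟_)
open import Data.Nat.Combinatorics using (_C_)
open import Data.Integer as ℤ using (ℤ; +_)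
open import Data.Rational as ℚ using (ℚ; 0ℚ; 1ℚ)
open import Relation.Nullary using (yes; no)

-- Polynomials are represented by their coefficient functions:
-- p j = coefficient of x^j.

QPoly : Set
QPoly = ℕ → ℚ

ZPoly : Set
ZPoly = ℕ → ℤ

sum1ℚ : ℕ → (ℕ → ℚ) → ℚ
sum1ℚ zero    f = 0ℚ
sum1ℚ (suc n) f = sum1ℚ n f ℚ.+ f (suc n)

sum0ℤ : ℕ → (ℕ → ℤ) → ℤ
sum0ℤ zero    f = f zero
sum0ℤ (suc n) f = sum0ℤ n f ℤ.+ f (suc n)

zeroQ : QPoly
zeroQ _ = 0ℚ

oneQ : QPoly
oneQ zero    = 1ℚ
oneQ (suc _) = 0ℚ

xTimesQ : QPoly → QPoly
xTimesQ p zero    = 0ℚ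
xTimesQ p (suc j) = p j

coefA : ℕ → ℕ → ℤ
coefA k i = (+ 6) ℤ.* (+ ((2 ℕ.* k) C (2 ℕ.* i))) ℤ.* ((+ (2 ℕ.^ (2 ℕ.* i ℕ.∸ 1))) ℤ.- (+ 1))

coefB : ℕ → ℕ → ℤ
coefB k i =
  (+ ((2 ℕ.* k) C (2 ℕ.* i ℕ.+ 2))) ℤ.* ((+ (2 ℕ.^ (2 ℕ.* i ℕ.+ 1))) ℤ.- (+ 1))
  ℤ.- (+ (2 ℕ.^ (2 ℕ.* i))) ℤ.* (+ ((2 ℕ.* k) C (2 ℕ.* i ℕ.+ 1)))
  ℤ.+ (+ ((2 ℕ.* k) C (2 ℕ.* i)))

-- P_k for k = m + 2, given prev with prev n = P_n for all n < k:
-- P_k = -1/((2k-1)(k-1)) Σ_{i=1}^{k-1} (a k i · x + b k i) P_{k-i}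
stepP : ℕ → (ℕ → QPoly) → QPoly
stepP m prev j =
  ℚ.- ((+ 1) ℚ./ ((3 ℕ.+ 2 ℕ.* m) ℕ.* suc m)) ℚ.*
  sum1ℚ (suc m) (λ i →
      ((coefA k i) ℚ./ 1) ℚ.* xTimesQ (prev (k ℕ.∸ i)) j
      ℚ.+ ((coefB k i) ℚ./ 1) ℚ.* prev (k ℕ.∸ i) j)
  where k = suc (suc m)

newP : ℕ → (ℕ → QPoly) → QPoly
newP zero          prev = zeroQ
newP (suc zero)    prev = oneQ
newP (suc (suc m)) prev = stepP m prev

-- table n m = P_m for all m ≤ n
table : ℕ → ℕ → QPoly
table zero    m = zeroQ
table (suc n) m with m ≟ suc n
... | yes _ = newP (suc n) (table n)
... | no  _ = table n m

P : ℕ → QPoly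
P k = table k k

constZ : ℤ → ZPoly
constZ c zero    = c
constZ c (suc _) = + 0

oneZ : ZPoly
oneZ = constZ (+ 1)

xZ : ZPoly
xZ zero          = + 0
xZ (suc zero)    = + 1
xZ (suc (suc _)) = + 0

_+Z_ : ZPoly → ZPoly → ZPoly
(p +Z q) j = p j ℤ.+ q j

_-Z_ : ZPoly → ZPoly → ZPoly
(p -Z q) j = p j ℤ.- q j

_*Z_ : ZPoly → ZPoly → ZPoly
(p *Z q) j = sum0ℤ j (λ i → p i ℤ.* q (j ℕ.∸ i))

_^Z_ : ZPoly → ℕ → ZPoly
p ^Z zero  = oneZ
p ^Z suc n = p *Z (p ^Z n)

RHS : ℕ → ZPoly
RHS ℓ = constZ (+ ((ℓ ℕ.+ 1) ℕ./ 2))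
        *Z (oneZ +Z ((oneZ -Z (constZ (+ 24) *Z xZ)) ^Z ((ℓ ℕ.∸ 1) ℕ./ 2)))

-- Let U_n be the sequence of polynomials U_0 = 0, U_1 = 1, U_(n+2) = U_(n+1) − 6x U_n, whose
-- characteristic roots α, β satisfy α + β = 1 and αβ = 6x. Both claims follow from P_k = U_(2k).
-- The binomial transforms Σ_r C(n, r) c^r U_(n−r) satisfy recurrences with roots α + c, β + c; as
-- α − 1 = −β, the transforms at c = −1 and c = −2 can be expressed through U and the transform at 1.
-- Splitting the transforms at c = 1, 2 into even and odd parts and summing by parts turns the
-- recursion defining P_k into the identity
--   Σ_(i=1)^(k−1) (a_(k,i) x + b_(k,i)) U_(2k−2i) = −(2k − 1)(k − 1) U_(2k).
-- The x^j-coefficient of U_(m+1) is (−6)^j C(m − j, j). For a prime ℓ = 2M + 1, where M + 1 ≡ 1/2,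
-- the congruence becomes 2 C(ℓ − j, j) ≡ 4^j C(M, j) (mod ℓ); it holds for j = 1 and persists as j
-- grows, because modulo ℓ both sides are multiplied by the same factor.

module Submission where

module Lemmas where

  open import Data.Empty using (⊥-elim)
  open import Data.Integer as ℤ using (ℤ; +_; -_; _+_; _*_; _-_; _^_; 0ℤ; 1ℤ)
  import Data.Integer.Divisibility.Signed as ℤ∣
  import Data.Integer.Properties as ℤP
  open import Algebra.Properties.CommutativeSemigroup ℤP.+-commutativeSemigroup
    using () renaming (interchange to +-interchange)
  open import Data.Integer.Tactic.RingSolver using (solve-∀)
  open import Data.Nat as ℕ using (ℕ; zero; suc; _∸_; _≤_; _<_; z≤n; s≤s; _≟_)
  open import Data.Nat.Combinatorics using (_C_; nCk+nC[k+1]≡[n+1]C[k+1]; k>n⇒nCk≡0; nCn≡1; nC1≡n)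
  import Data.Nat.Divisibility as ℕ∣
  open import Data.Nat.DivMod using (m*n/n≡m)
  open import Data.Nat.Induction using (<-rec)
  open import Data.Nat.Primality using (Prime; euclidsLemma; composite-≢; prime⇒¬composite; prime⇒nonZero)
  import Data.Nat.Properties as ℕP
  import Data.Nat.Tactic.RingSolver as ℕ-Solver
  open import Data.Product using (_×_; _,_; proj₁; ∃)
  open import Data.Rational as ℚ using (ℚ)
  import Data.Rational.Properties as ℚP
  open import Data.Rational.Unnormalised as ℚᵘ using (mkℚᵘ; *≡*)
  import Data.Rational.Unnormalised.Properties as ℚᵘP
  open import Data.Sum using (_⊎_; inj₁; inj₂)
  open import Relation.Binary.PropositionalEquality
    using (_≡_; refl; sym; trans; cong; cong₂; subst; module ≡-Reasoning)
  open import Relation.Nullary using (yes; no)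

  open import Defs

  sum₁ : ℕ → (ℕ → ℤ) → ℤ
  sum₁ zero    g = 0ℤ
  sum₁ (suc N) g = sum₁ N g + g (suc N)

  sum₀ : ℕ → (ℕ → ℤ) → ℤ
  sum₀ N g = g 0 + sum₁ N g

  sum₁-cong : ∀ N {g h : ℕ → ℤ} → (∀ i → 0 < i → i ≤ N → g i ≡ h i) → sum₁ N g ≡ sum₁ N h
  sum₁-cong zero    g≡h = refl
  sum₁-cong (suc N) g≡h =
    cong₂ _+_ (sum₁-cong N λ i 0<i i≤N → g≡h i 0<i (ℕP.m≤n⇒m≤1+n i≤N)) (g≡h (suc N) (s≤s z≤n) ℕP.≤-refl)

  sum₀-cong : ∀ N {g h : ℕ → ℤ} → (∀ i → i ≤ N → g i ≡ h i) → sum₀ N g ≡ sum₀ N h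
  sum₀-cong N g≡h = cong₂ _+_ (g≡h 0 z≤n) (sum₁-cong N λ i _ i≤N → g≡h i i≤N)

  sum₁-0 : ∀ N → sum₁ N (λ _ → 0ℤ) ≡ 0ℤ
  sum₁-0 zero    = refl
  sum₁-0 (suc N) = cong (_+ 0ℤ) (sum₁-0 N)

  sum₁-+ : ∀ N (g h : ℕ → ℤ) → sum₁ N (λ i → g i + h i) ≡ sum₁ N g + sum₁ N h
  sum₁-+ zero    g h = refl
  sum₁-+ (suc N) g h rewrite sum₁-+ N g h = +-interchange (sum₁ N g) (sum₁ N h) (g (suc N)) (h (suc N))

  sum₁-- : ∀ N (g h : ℕ → ℤ) → sum₁ N (λ i → g i - h i) ≡ sum₁ N g - sum₁ N h
  sum₁-- zero    g h = refl
  sum₁-- (suc N) g h rewrite sum₁-- N g h = rearrange (sum₁ N g) (sum₁ N h) (g (suc N)) (h (suc N))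
    where rearrange : ∀ a b c d → a - b + (c - d) ≡ a + c - (b + d)
          rearrange = solve-∀

  sum₁-* : ∀ N c (g : ℕ → ℤ) → sum₁ N (λ i → c * g i) ≡ c * sum₁ N g
  sum₁-* zero    c g = sym (ℤP.*-zeroʳ c)
  sum₁-* (suc N) c g rewrite sum₁-* N c g = sym (ℤP.*-distribˡ-+ c (sum₁ N g) (g (suc N)))

  sum₁-neg : ∀ N (g : ℕ → ℤ) → sum₁ N (λ i → - g i) ≡ - sum₁ N g
  sum₁-neg zero    g = refl
  sum₁-neg (suc N) g rewrite sum₁-neg N g = sym (ℤP.neg-distrib-+ (sum₁ N g) (g (suc N)))

  sum₀-+-* : ∀ N c (g h : ℕ → ℤ) → sum₀ N (λ i → c * g i + h i) ≡ c * sum₀ N g + sum₀ N h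
  sum₀-+-* N c g h rewrite sum₁-+ N (λ i → c * g i) h | sum₁-* N c g = rearrange c (g 0) (h 0) (sum₁ N g) (sum₁ N h)
    where rearrange : ∀ c g₀ h₀ sg sh → c * g₀ + h₀ + (c * sg + sh) ≡ c * (g₀ + sg) + (h₀ + sh)
          rearrange = solve-∀

  sum₀---* : ∀ N c (g h : ℕ → ℤ) → sum₀ N (λ i → g i - c * h i) ≡ sum₀ N g - c * sum₀ N h
  sum₀---* N c g h rewrite sum₁-- N g (λ i → c * h i) | sum₁-* N c h = rearrange c (g 0) (h 0) (sum₁ N g) (sum₁ N h)
    where rearrange : ∀ c g₀ h₀ sg sh → g₀ - c * h₀ + (sg - c * sh) ≡ g₀ + sg - c * (h₀ + sh)
          rearrange = solve-∀

  sum₁-peel : ∀ N (g : ℕ → ℤ) → sum₁ (suc N) g ≡ g 1 + sum₁ N (λ i → g (suc i))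
  sum₁-peel zero    g = ℤP.+-comm 0ℤ (g 1)
  sum₁-peel (suc N) g rewrite sum₁-peel N g = ℤP.+-assoc (g 1) _ _

  sum₀-peel : ∀ N (g : ℕ → ℤ) → sum₀ (suc N) g ≡ g 0 + sum₀ N (λ i → g (suc i))
  sum₀-peel N g = cong (λ z → g 0 + z) (sum₁-peel N g)

  sum₁-telescope : ∀ N (g : ℕ → ℤ) → sum₁ N (λ i → g (suc i) - g i) ≡ g (suc N) - g 1
  sum₁-telescope zero    g = sym (ℤP.+-inverseʳ (g 1))
  sum₁-telescope (suc N) g rewrite sum₁-telescope N g = cancel (g (suc N)) (g 1) (g (suc (suc N)))
    where cancel : ∀ a b c → a - b + (c - a) ≡ c - b
          cancel = solve-∀

  double : ℕ → ℕ
  double zero    = zero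
  double (suc k) = suc (suc (double k))

  double≡2* : ∀ k → double k ≡ 2 ℕ.* k
  double≡2* zero    = refl
  double≡2* (suc k) = trans (cong (λ x → suc (suc x)) (double≡2* k)) (sym (ℕP.*-suc 2 k))

  double-∸ : ∀ k i → double k ∸ double i ≡ double (k ∸ i)
  double-∸ zero    zero    = refl
  double-∸ zero    (suc i) = refl
  double-∸ (suc k) zero    = refl
  double-∸ (suc k) (suc i) = double-∸ k i

  double-∸-suc : ∀ k i → suc i ≤ k → double k ∸ suc (double i) ≡ suc (double (k ∸ suc i))
  double-∸-suc (suc k) zero    _         = refl
  double-∸-suc (suc k) (suc i) (s≤s i<k) = double-∸-suc k i i<k

  pos-double : ∀ k → + double k ≡ + 2 * + k
  pos-double k = trans (cong +_ (double≡2* k)) (ℤP.pos-* 2 k)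

  double/2 : ∀ M → double M ℕ./ 2 ≡ M
  double/2 M = trans (cong (ℕ._/ 2) (trans (double≡2* M) (ℕP.*-comm 2 M))) (m*n/n≡m M 2)

  sum₀-double : ∀ k (g : ℕ → ℤ) →
                sum₀ (double k) g ≡ sum₀ k (λ i → g (double i)) + sum₁ k (λ i → g (double i ∸ 1))
  sum₀-double zero    g = sym (ℤP.+-identityʳ _)
  sum₀-double (suc k) g = begin
    g 0 + (sum₁ (double k) g + g (suc (double k)) + g (double (suc k)))
      ≡⟨ reassoc (g 0) _ _ _ ⟩
    sum₀ (double k) g + g (suc (double k)) + g (double (suc k))
      ≡⟨ cong (λ z → z + g (suc (double k)) + g (double (suc k))) (sum₀-double k g) ⟩
    sum₀ k (λ i → g (double i)) + sum₁ k (λ i → g (double i ∸ 1)) + g (suc (double k)) + g (double (suc k))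
      ≡⟨ regroup (g 0) _ _ _ _ ⟩
    g 0 + (sum₁ k (λ i → g (double i)) + g (double (suc k)))
      + (sum₁ k (λ i → g (double i ∸ 1)) + g (suc (double k))) ∎
    where
    open ≡-Reasoning
    reassoc : ∀ a b c d → a + (b + c + d) ≡ a + b + c + d
    reassoc = solve-∀
    regroup : ∀ a b c d e → a + b + c + d + e ≡ a + (b + e) + (c + d)
    regroup = solve-∀

  neg-^-double : ∀ c i → (- c) ^ double i ≡ c ^ double i
  neg-^-double c zero    = refl
  neg-^-double c (suc i) = trans (negSquare c ((- c) ^ double i)) (cong (λ z → c * (c * z)) (neg-^-double c i))
    where negSquare : ∀ c x → - c * (- c * x) ≡ c * (c * x)
          negSquare = solve-∀

  neg-^-suc-double : ∀ c i → (- c) ^ suc (double i) ≡ - (c ^ suc (double i))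
  neg-^-suc-double c i =
    trans (cong (λ z → - c * z) (neg-^-double c i)) (sym (ℤP.neg-distribˡ-* c (c ^ double i)))

  pos-^ : ∀ m r → (+ m) ^ r ≡ + (m ℕ.^ r)
  pos-^ m zero    = refl
  pos-^ m (suc r) = trans (cong (λ z → + m * z) (pos-^ m r)) (sym (ℤP.pos-* m (m ℕ.^ r)))

  ^-distribʳ-* : ∀ a b j → (a * b) ^ j ≡ a ^ j * b ^ j
  ^-distribʳ-* a b zero    = refl
  ^-distribʳ-* a b (suc j) = trans (cong (λ z → a * b * z) (^-distribʳ-* a b j)) (interchange a b (a ^ j) (b ^ j))
    where interchange : ∀ a b x y → a * b * (x * y) ≡ a * x * (b * y)
          interchange = solve-∀

  -- Recurrences of polynomial sequences and binomial transforms

  xTimes : ZPoly → ZPoly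
  xTimes g zero    = 0ℤ
  xTimes g (suc j) = g j

  xTimes-cong : ∀ {g h : ZPoly} → (∀ j → g j ≡ h j) → ∀ j → xTimes g j ≡ xTimes h j
  xTimes-cong g≡h zero    = refl
  xTimes-cong g≡h (suc j) = g≡h j

  xTimes-* : ∀ c (g : ZPoly) j → c * xTimes g j ≡ xTimes (λ i → c * g i) j
  xTimes-* c g zero    = ℤP.*-zeroʳ c
  xTimes-* c g (suc j) = refl

  PolySeq : Set
  PolySeq = ℕ → ZPoly

  -- Characteristic polynomial t² − p t − (q − 6x).
  record Recurrence (p q : ℤ) (a : PolySeq) : Set where
    field
      step : ∀ n j → a (suc (suc n)) j ≡ p * a (suc n) j + q * a n j - + 6 * xTimes (a n) j
  open Recurrence

  recurrence-unique : ∀ {p q a b} → Recurrence p q a → Recurrence p q b →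
                      (∀ j → a 0 j ≡ b 0 j) → (∀ j → a 1 j ≡ b 1 j) → ∀ n j → a n j ≡ b n j
  recurrence-unique {p} {q} {a} {b} ra rb a₀≡b₀ a₁≡b₁ n = proj₁ (agree n)
    where
    agree : ∀ n → (∀ j → a n j ≡ b n j) × (∀ j → a (suc n) j ≡ b (suc n) j)
    agree zero    = a₀≡b₀ , a₁≡b₁
    agree (suc n) with agree n
    ... | aₙ≡bₙ , aₙ₊₁≡bₙ₊₁ = aₙ₊₁≡bₙ₊₁ , λ j → begin
      a (suc (suc n)) j
        ≡⟨ step ra n j ⟩
      p * a (suc n) j + q * a n j - + 6 * xTimes (a n) j
        ≡⟨ cong₂ (λ u v → p * u + q * v - + 6 * xTimes (a n) j) (aₙ₊₁≡bₙ₊₁ j) (aₙ≡bₙ j) ⟩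
      p * b (suc n) j + q * b n j - + 6 * xTimes (a n) j
        ≡⟨ cong (λ w → p * b (suc n) j + q * b n j - + 6 * w) (xTimes-cong aₙ≡bₙ j) ⟩
      p * b (suc n) j + q * b n j - + 6 * xTimes (b n) j
        ≡⟨ step rb n j ⟨
      b (suc (suc n)) j ∎
      where open ≡-Reasoning

  recurrence-cong : ∀ {p q a b} → (∀ n j → a n j ≡ b n j) → Recurrence p q a → Recurrence p q b
  step (recurrence-cong {p} {q} {a} {b} a≡b ra) n j = begin
    b (suc (suc n)) j                                   ≡⟨ a≡b (suc (suc n)) j ⟨
    a (suc (suc n)) j                                   ≡⟨ step ra n j ⟩
    p * a (suc n) j + q * a n j - + 6 * xTimes (a n) j  ≡⟨ cong₂ (λ u v → p * u + q * v - + 6 * xTimes (a n) j)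
                                                              (a≡b (suc n) j) (a≡b n j) ⟩
    p * b (suc n) j + q * b n j - + 6 * xTimes (a n) j  ≡⟨ cong (λ w → p * b (suc n) j + q * b n j - + 6 * w)
                                                              (xTimes-cong (a≡b n) j) ⟩
    p * b (suc n) j + q * b n j - + 6 * xTimes (b n) j  ∎
    where open ≡-Reasoning

  recurrence-+ : ∀ {p q a b} → Recurrence p q a → Recurrence p q b → Recurrence p q (λ n j → a n j + b n j)
  step (recurrence-+ {p} {q} {a} {b} ra rb) n j rewrite step ra n j | step rb n j =
    trans (rearrange p q (a (suc n) j) (b (suc n) j) (a n j) (b n j) (xTimes (a n) j) (xTimes (b n) j))
          (cong (λ w → p * (a (suc n) j + b (suc n) j) + q * (a n j + b n j) - + 6 * w) (xTimes-+ j))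
    where
    rearrange : ∀ p q a₁ b₁ a₀ b₀ xa xb →
                p * a₁ + q * a₀ - + 6 * xa + (p * b₁ + q * b₀ - + 6 * xb)
                ≡ p * (a₁ + b₁) + q * (a₀ + b₀) - + 6 * (xa + xb)
    rearrange = solve-∀
    xTimes-+ : ∀ j → xTimes (a n) j + xTimes (b n) j ≡ xTimes (λ i → a n i + b n i) j
    xTimes-+ zero    = refl
    xTimes-+ (suc j) = refl

  recurrence-* : ∀ {p q a} c → Recurrence p q a → Recurrence p q (λ n j → c * a n j)
  step (recurrence-* {p} {q} {a} c ra) n j rewrite step ra n j =
    trans (rearrange p q c (a (suc n) j) (a n j) (xTimes (a n) j))
          (cong (λ w → p * (c * a (suc n) j) + q * (c * a n j) - + 6 * w) (xTimes-* c (a n) j))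
    where
    rearrange : ∀ p q c a₁ a₀ x → c * (p * a₁ + q * a₀ - + 6 * x) ≡ p * (c * a₁) + q * (c * a₀) - + 6 * (c * x)
    rearrange = solve-∀

  recurrence-neg : ∀ {p q a} → Recurrence p q a → Recurrence p q (λ n j → - a n j)
  recurrence-neg ra = recurrence-cong (λ n j → ℤP.-1*i≡-i _) (recurrence-* (- 1ℤ) ra)

  recurrence-- : ∀ {p q a b} → Recurrence p q a → Recurrence p q b → Recurrence p q (λ n j → a n j - b n j)
  recurrence-- ra rb = recurrence-+ ra (recurrence-neg rb)

  altSign : ℕ → ℤ
  altSign zero    = 1ℤ
  altSign (suc n) = - altSign n

  altSign-double : ∀ k → altSign (double k) ≡ 1ℤ
  altSign-double zero    = refl
  altSign-double (suc k) = trans (ℤP.neg-involutive (altSign (double k))) (altSign-double k)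

  recurrence-altSign : ∀ {p q a} → Recurrence p q a → Recurrence (- p) q (λ n j → altSign n * a n j)
  step (recurrence-altSign {p} {q} {a} ra) n j =
    trans (cong (λ z → - - altSign n * z) (step ra n j))
    (trans (rearrange (altSign n) p q (a (suc n) j) (a n j) (xTimes (a n) j))
           (cong (λ w → - p * (- altSign n * a (suc n) j) + q * (altSign n * a n j) - + 6 * w)
                 (xTimes-* (altSign n) (a n) j)))
    where
    rearrange : ∀ s p q a₁ a₀ x → - - s * (p * a₁ + q * a₀ - + 6 * x) ≡ - p * (- s * a₁) + q * (s * a₀) - + 6 * (s * x)
    rearrange = solve-∀

  binomialTransform : ℤ → PolySeq → PolySeq
  binomialTransform c h n j = sum₀ n (λ r → + (n C r) * c ^ r * h (n ∸ r) j)

  binomialTransform-cong : ∀ c {h h′ : PolySeq} → (∀ m j → h m j ≡ h′ m j) →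
                           ∀ n j → binomialTransform c h n j ≡ binomialTransform c h′ n j
  binomialTransform-cong c h≡h′ n j = sum₀-cong n λ r _ → cong (λ z → + (n C r) * c ^ r * z) (h≡h′ (n ∸ r) j)

  binomialTransform-suc : ∀ c (h : PolySeq) n j →
    binomialTransform c h (suc n) j ≡ binomialTransform c (λ m → h (suc m)) n j + c * binomialTransform c h n j
  binomialTransform-suc c h n j = begin
    binomialTransform c h (suc n) j
      ≡⟨ sum₀-peel n T ⟩
    T 0 + sum₀ n (λ r → T (suc r))
      ≡⟨ cong (λ z → T 0 + z) (sum₀-cong n λ r _ → pascal r) ⟩
    T 0 + sum₀ n (λ r → c * S r + S′ r)
      ≡⟨ cong (λ z → T 0 + z) (sum₀-+-* n c S S′) ⟩
    T 0 + (c * sum₀ n S + sum₀ n S′)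
      ≡⟨ cong (λ z → T 0 + (c * sum₀ n S + z)) shiftedSum ⟩
    T 0 + (c * sum₀ n S + sum₁ n S″)
      ≡⟨ rearrange (T 0) (c * sum₀ n S) (sum₁ n S″) ⟩
    binomialTransform c (λ m → h (suc m)) n j + c * binomialTransform c h n j ∎
    where
    open ≡-Reasoning
    T S S′ S″ : ℕ → ℤ
    T r = + (suc n C r) * c ^ r * h (suc n ∸ r) j
    S r = + (n C r) * c ^ r * h (n ∸ r) j
    S′ r = + (n C suc r) * c ^ suc r * h (n ∸ r) j
    S″ r = + (n C r) * c ^ r * h (suc (n ∸ r)) j
    pascal : ∀ r → T (suc r) ≡ c * S r + S′ r
    pascal r = begin
      + (suc n C suc r) * c ^ suc r * h (n ∸ r) j
        ≡⟨ cong (λ z → + z * c ^ suc r * h (n ∸ r) j) (nCk+nC[k+1]≡[n+1]C[k+1] n r) ⟨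
      + (n C r ℕ.+ n C suc r) * c ^ suc r * h (n ∸ r) j
        ≡⟨ cong (λ z → z * c ^ suc r * h (n ∸ r) j) (ℤP.pos-+ (n C r) (n C suc r)) ⟩
      (+ (n C r) + + (n C suc r)) * c ^ suc r * h (n ∸ r) j
        ≡⟨ distrib (+ (n C r)) (+ (n C suc r)) c (c ^ r) (h (n ∸ r) j) ⟩
      c * S r + S′ r ∎
      where distrib : ∀ a b c e f → (a + b) * (c * e) * f ≡ c * (a * e * f) + b * (c * e) * f
            distrib = solve-∀
    shiftedSum : sum₀ n S′ ≡ sum₁ n S″
    shiftedSum = begin
      sum₀ n S′
        ≡⟨ sum₁-peel n (λ i → + (n C i) * c ^ i * h (suc n ∸ i) j) ⟨
      sum₁ n (λ i → + (n C i) * c ^ i * h (suc n ∸ i) j) + + (n C suc n) * c ^ suc n * h (n ∸ n) j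
        ≡⟨ cong (λ z → sum₁ n (λ i → + (n C i) * c ^ i * h (suc n ∸ i) j) + + z * c ^ suc n * h (n ∸ n) j)
                (k>n⇒nCk≡0 (ℕP.n<1+n n)) ⟩
      sum₁ n (λ i → + (n C i) * c ^ i * h (suc n ∸ i) j) + 0ℤ
        ≡⟨ ℤP.+-identityʳ _ ⟩
      sum₁ n (λ i → + (n C i) * c ^ i * h (suc n ∸ i) j)
        ≡⟨ sum₁-cong n (λ i _ i≤n → cong (λ m → + (n C i) * c ^ i * h m j) (ℕP.+-∸-assoc 1 i≤n)) ⟩
      sum₁ n S″ ∎
    rearrange : ∀ a b d → a + (b + d) ≡ a + d + b
    rearrange = solve-∀

  binomialTransform-xTimes : ∀ c (h : PolySeq) n j →
    binomialTransform c (λ m → xTimes (h m)) n j ≡ xTimes (binomialTransform c h n) j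
  binomialTransform-xTimes c h n zero =
    trans (sum₀-cong n λ r _ → ℤP.*-zeroʳ (+ (n C r) * c ^ r)) (trans (ℤP.+-identityˡ _) (sum₁-0 n))
  binomialTransform-xTimes c h n (suc j) = refl

  binomialTransform-step : ∀ c (h g : PolySeq) n j →
    binomialTransform c (λ m j → h m j - + 6 * xTimes (g m) j) n j
    ≡ binomialTransform c h n j - + 6 * xTimes (binomialTransform c g n) j
  binomialTransform-step c h g n j = begin
    sum₀ n (λ r → C′ r * (h (n ∸ r) j - + 6 * xTimes (g (n ∸ r)) j))
      ≡⟨ sum₀-cong n (λ r _ → distrib (C′ r) (h (n ∸ r) j) (xTimes (g (n ∸ r)) j)) ⟩
    sum₀ n (λ r → C′ r * h (n ∸ r) j - + 6 * (C′ r * xTimes (g (n ∸ r)) j))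
      ≡⟨ sum₀---* n (+ 6) (λ r → C′ r * h (n ∸ r) j) (λ r → C′ r * xTimes (g (n ∸ r)) j) ⟩
    binomialTransform c h n j - + 6 * binomialTransform c (λ m → xTimes (g m)) n j
      ≡⟨ cong (λ z → binomialTransform c h n j - + 6 * z) (binomialTransform-xTimes c g n j) ⟩
    binomialTransform c h n j - + 6 * xTimes (binomialTransform c g n) j ∎
    where
    open ≡-Reasoning
    C′ : ℕ → ℤ
    C′ r = + (n C r) * c ^ r
    distrib : ∀ a u v → a * (u - + 6 * v) ≡ a * u - + 6 * (a * v)
    distrib = solve-∀

  -- If a has characteristic roots α, β then its binomial transform at c has roots α + c, β + c.
  binomialTransform-recurrence : ∀ c {h} → Recurrence 1ℤ 0ℤ h →
                                 Recurrence (1ℤ + + 2 * c) (- (c + c * c)) (binomialTransform c h)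
  step (binomialTransform-recurrence c {h} rh) n j = begin
    a (suc (suc n)) j
      ≡⟨ binomialTransform-suc c h (suc n) j ⟩
    binomialTransform c h₁ (suc n) j + c * a (suc n) j
      ≡⟨ cong (_+ c * a (suc n) j) (binomialTransform-suc c h₁ n j) ⟩
    binomialTransform c h₂ n j + c * s + c * a (suc n) j
      ≡⟨ cong (λ z → z + c * s + c * a (suc n) j)
              (trans (binomialTransform-cong c h₂-step n j) (binomialTransform-step c h₁ h n j)) ⟩
    s - + 6 * xTimes (a n) j + c * s + c * a (suc n) j
      ≡⟨ cong (λ z → z - + 6 * xTimes (a n) j + c * z + c * a (suc n) j) s≡ ⟩
    (a (suc n) j - c * a n j) - + 6 * xTimes (a n) j + c * (a (suc n) j - c * a n j) + c * a (suc n) j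
      ≡⟨ collect (a (suc n) j) (a n j) c (xTimes (a n) j) ⟩
    (1ℤ + + 2 * c) * a (suc n) j + - (c + c * c) * a n j - + 6 * xTimes (a n) j ∎
    where
    open ≡-Reasoning
    a = binomialTransform c h
    h₁ h₂ : PolySeq
    h₁ m = h (suc m)
    h₂ m = h (suc (suc m))
    s = binomialTransform c h₁ n j
    h₂-step : ∀ m j → h₂ m j ≡ h₁ m j - + 6 * xTimes (h m) j
    h₂-step m j = trans (step rh m j) (simplify (h (suc m) j) (h m j) (xTimes (h m) j))
      where simplify : ∀ u v x → 1ℤ * u + 0ℤ * v - + 6 * x ≡ u - + 6 * x
            simplify = solve-∀
    s≡ : s ≡ a (suc n) j - c * a n j
    s≡ = trans (addSub s (c * a n j)) (cong (_- c * a n j) (sym (binomialTransform-suc c h n j)))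
      where addSub : ∀ u v → u ≡ u + v - v
            addSub = solve-∀
    collect : ∀ a₁ a₀ c x → (a₁ - c * a₀) - + 6 * x + c * (a₁ - c * a₀) + c * a₁
                            ≡ (1ℤ + + 2 * c) * a₁ + - (c + c * c) * a₀ - + 6 * x
    collect = solve-∀

  U : PolySeq
  U zero          j       = 0ℤ
  U (suc zero)    zero    = 1ℤ
  U (suc zero)    (suc j) = 0ℤ
  U (suc (suc m)) j       = U (suc m) j - + 6 * xTimes (U m) j

  U⁺ : PolySeq
  U⁺ m = U (suc m)

  U-recurrence : Recurrence 1ℤ 0ℤ U
  step U-recurrence n j = simplify (U (suc n) j) (U n j) (xTimes (U n) j)
    where simplify : ∀ a b x → a - + 6 * x ≡ 1ℤ * a + 0ℤ * b - + 6 * x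
          simplify = solve-∀

  U⁺-recurrence : Recurrence 1ℤ 0ℤ U⁺
  step U⁺-recurrence n = step U-recurrence (suc n)

  U-2 : ∀ j → U 2 j ≡ U 1 j
  U-2 zero    = refl
  U-2 (suc j) = refl

  -- As α + β = 1, the transform at −1 has roots −β, −α and the one at −2 has roots −(β + 1), −(α + 1);
  -- after the sign change these are the roots of U and of the transform at 1, so it remains to compare
  -- the first two terms.
  altSign-binomialTransform-U : ∀ n j → altSign n * binomialTransform (- 1ℤ) U n j ≡ - U n j
  altSign-binomialTransform-U = recurrence-unique
    (recurrence-altSign (binomialTransform-recurrence (- 1ℤ) U-recurrence)) (recurrence-neg U-recurrence)
    (λ j → refl) λ { zero → refl ; (suc j) → refl }

  altSign-binomialTransform-U⁺ : ∀ n j → altSign n * binomialTransform (- 1ℤ) U⁺ n j ≡ U⁺ n j - U n j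
  altSign-binomialTransform-U⁺ = recurrence-unique
    (recurrence-altSign (binomialTransform-recurrence (- 1ℤ) U⁺-recurrence))
    (recurrence-- U⁺-recurrence U-recurrence)
    (λ { zero → refl ; (suc j) → refl }) λ { zero → refl ; (suc j) → refl }

  binomialTransform-U⁺-1-2 : ∀ n j →
    binomialTransform 1ℤ U⁺ n j - altSign n * binomialTransform (- + 2) U⁺ n j ≡ binomialTransform 1ℤ U n j
  binomialTransform-U⁺-1-2 = recurrence-unique
    (recurrence-- (binomialTransform-recurrence 1ℤ U⁺-recurrence)
                  (recurrence-altSign (binomialTransform-recurrence (- + 2) U⁺-recurrence)))
    (binomialTransform-recurrence 1ℤ U-recurrence)
    (λ { zero → refl ; (suc j) → refl }) λ { zero → refl ; (suc j) → refl }

  -- The recursion for P_k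

  1*[a-b]≡c⇒b≡a-c : ∀ a b {c} → 1ℤ * (a - b) ≡ c → b ≡ a - c
  1*[a-b]≡c⇒b≡a-c a b refl = solve a b
    where solve : ∀ a b → b ≡ a - 1ℤ * (a - b)
          solve = solve-∀

  module EvenOddParts (k j : ℕ) where

    n : ℕ
    n = double k

    evenPart oddPart : ℤ → PolySeq → ℤ
    evenPart c h = sum₀ k (λ i → + (n C double i) * c ^ double i * h (double (k ∸ i)) j)
    oddPart  c h = sum₁ k (λ i → + (n C (double i ∸ 1)) * c ^ (double i ∸ 1) * h (suc (double (k ∸ i))) j)

    binomialTransform-evenOdd : ∀ c h → binomialTransform c h n j ≡ evenPart c h + oddPart c h
    binomialTransform-evenOdd c h = trans (sum₀-double k T) (cong₂ _+_
      (sum₀-cong k λ i _ → cong (λ m → + (n C double i) * c ^ double i * h m j) (double-∸ k i))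
      (sum₁-cong k odd))
      where
      T : ℕ → ℤ
      T r = + (n C r) * c ^ r * h (n ∸ r) j
      odd : ∀ i → 0 < i → i ≤ k →
            T (double i ∸ 1) ≡ + (n C (double i ∸ 1)) * c ^ (double i ∸ 1) * h (suc (double (k ∸ i))) j
      odd (suc i) _ i<k = cong (λ m → + (n C suc (double i)) * c ^ suc (double i) * h m j) (double-∸-suc k i i<k)

    binomialTransform-neg-evenOdd : ∀ c h → binomialTransform (- c) h n j ≡ evenPart c h - oddPart c h
    binomialTransform-neg-evenOdd c h = trans (binomialTransform-evenOdd (- c) h) (cong₂ _+_
      (sum₀-cong k λ i _ → cong (λ z → + (n C double i) * z * h (double (k ∸ i)) j) (neg-^-double c i))
      (trans (sum₁-cong k odd) (sum₁-neg k _)))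
      where
      odd : ∀ i → 0 < i → i ≤ k →
            + (n C (double i ∸ 1)) * (- c) ^ (double i ∸ 1) * h (suc (double (k ∸ i))) j
            ≡ - (+ (n C (double i ∸ 1)) * c ^ (double i ∸ 1) * h (suc (double (k ∸ i))) j)
      odd (suc i) _ _ = trans (cong (λ z → + (n C suc (double i)) * z * h (suc (double (k ∸ suc i))) j)
                                    (neg-^-suc-double c i))
                              (negMiddle (+ (n C suc (double i))) (c ^ suc (double i)) (h (suc (double (k ∸ suc i))) j))
        where negMiddle : ∀ a b x → a * - b * x ≡ - (a * b * x)
              negMiddle = solve-∀

    private
      evenParity : altSign n ≡ 1ℤ
      evenParity = altSign-double k

    oddPart-U : oddPart 1ℤ U ≡ evenPart 1ℤ U - - U n j
    oddPart-U = 1*[a-b]≡c⇒b≡a-c (evenPart 1ℤ U) (oddPart 1ℤ U) (begin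
      1ℤ * (evenPart 1ℤ U - oddPart 1ℤ U)
        ≡⟨ cong₂ _*_ (sym evenParity) (sym (binomialTransform-neg-evenOdd 1ℤ U)) ⟩
      altSign n * binomialTransform (- 1ℤ) U n j
        ≡⟨ altSign-binomialTransform-U n j ⟩
      - U n j ∎)
      where open ≡-Reasoning

    oddPart-U⁺ : oddPart 1ℤ U⁺ ≡ evenPart 1ℤ U⁺ - (U⁺ n j - U n j)
    oddPart-U⁺ = 1*[a-b]≡c⇒b≡a-c (evenPart 1ℤ U⁺) (oddPart 1ℤ U⁺) (begin
      1ℤ * (evenPart 1ℤ U⁺ - oddPart 1ℤ U⁺)
        ≡⟨ cong₂ _*_ (sym evenParity) (sym (binomialTransform-neg-evenOdd 1ℤ U⁺)) ⟩
      altSign n * binomialTransform (- 1ℤ) U⁺ n j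
        ≡⟨ altSign-binomialTransform-U⁺ n j ⟩
      U⁺ n j - U n j ∎)
      where open ≡-Reasoning

    evenPart-2-U⁺ : evenPart (+ 2) U⁺ ≡ evenPart 1ℤ U⁺ + oddPart 1ℤ U⁺ + oddPart (+ 2) U⁺
                                         - (evenPart 1ℤ U + oddPart 1ℤ U)
    evenPart-2-U⁺ = solveFor (evenPart 1ℤ U⁺ + oddPart 1ℤ U⁺) (evenPart (+ 2) U⁺) (oddPart (+ 2) U⁺) (begin
      evenPart 1ℤ U⁺ + oddPart 1ℤ U⁺ - 1ℤ * (evenPart (+ 2) U⁺ - oddPart (+ 2) U⁺)
        ≡⟨ cong₂ (λ u v → u - v * (evenPart (+ 2) U⁺ - oddPart (+ 2) U⁺))
                 (sym (binomialTransform-evenOdd 1ℤ U⁺)) (sym evenParity) ⟩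
      binomialTransform 1ℤ U⁺ n j - altSign n * (evenPart (+ 2) U⁺ - oddPart (+ 2) U⁺)
        ≡⟨ cong (λ u → binomialTransform 1ℤ U⁺ n j - altSign n * u) (binomialTransform-neg-evenOdd (+ 2) U⁺) ⟨
      binomialTransform 1ℤ U⁺ n j - altSign n * binomialTransform (- + 2) U⁺ n j
        ≡⟨ binomialTransform-U⁺-1-2 n j ⟩
      binomialTransform 1ℤ U n j
        ≡⟨ binomialTransform-evenOdd 1ℤ U ⟩
      evenPart 1ℤ U + oddPart 1ℤ U ∎)
      where
      open ≡-Reasoning
      solveFor : ∀ x z w {y} → x - 1ℤ * (z - w) ≡ y → z ≡ x + w - y
      solveFor x z w refl = solution x z w
        where solution : ∀ x z w → z ≡ x + w - (x - 1ℤ * (z - w))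
              solution = solve-∀

  pascalℤ : ∀ n j → + (suc n C suc j) ≡ + (n C j) + + (n C suc j)
  pascalℤ n j = trans (cong +_ (sym (nCk+nC[k+1]≡[n+1]C[k+1] n j))) (ℤP.pos-+ (n C j) (n C suc j))

  [1+j]C[1+j]+jC : ∀ n j → suc j ℕ.* (n C suc j) ℕ.+ j ℕ.* (n C j) ≡ n ℕ.* (n C j)
  [1+j]C[1+j]+jC zero    zero    = refl
  [1+j]C[1+j]+jC zero    (suc j) = cong₂ ℕ._+_ (ℕP.*-zeroʳ (suc (suc j))) (ℕP.*-zeroʳ (suc j))
  [1+j]C[1+j]+jC (suc n) zero    rewrite nC1≡n (suc n) = simplify n
    where simplify : ∀ n → suc n ℕ.+ 0 ℕ.+ 0 ≡ suc (n ℕ.* 1)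
          simplify = ℕ-Solver.solve-∀
  [1+j]C[1+j]+jC (suc n) (suc j) = begin
    suc (suc j) ℕ.* (suc n C suc (suc j)) ℕ.+ suc j ℕ.* (suc n C suc j)
      ≡⟨ cong₂ (λ u v → suc (suc j) ℕ.* u ℕ.+ suc j ℕ.* v)
               (nCk+nC[k+1]≡[n+1]C[k+1] n (suc j)) (nCk+nC[k+1]≡[n+1]C[k+1] n j) ⟨
    suc (suc j) ℕ.* (c₁ ℕ.+ c₂) ℕ.+ suc j ℕ.* (c₀ ℕ.+ c₁)
      ≡⟨ regroup j c₀ c₁ c₂ ⟩
    c₁ ℕ.+ (suc (suc j) ℕ.* c₂ ℕ.+ suc j ℕ.* c₁) ℕ.+ c₀ ℕ.+ (suc j ℕ.* c₁ ℕ.+ j ℕ.* c₀)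
      ≡⟨ cong₂ (λ u v → c₁ ℕ.+ u ℕ.+ c₀ ℕ.+ v) ([1+j]C[1+j]+jC n (suc j)) ([1+j]C[1+j]+jC n j) ⟩
    c₁ ℕ.+ n ℕ.* c₁ ℕ.+ c₀ ℕ.+ n ℕ.* c₀
      ≡⟨ factor n c₀ c₁ ⟩
    suc n ℕ.* (c₀ ℕ.+ c₁)
      ≡⟨ cong (suc n ℕ.*_) (nCk+nC[k+1]≡[n+1]C[k+1] n j) ⟩
    suc n ℕ.* (suc n C suc j) ∎
    where
    open ≡-Reasoning
    c₀ = n C j
    c₁ = n C suc j
    c₂ = n C suc (suc j)
    regroup : ∀ j c₀ c₁ c₂ → suc (suc j) ℕ.* (c₁ ℕ.+ c₂) ℕ.+ suc j ℕ.* (c₀ ℕ.+ c₁)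
              ≡ c₁ ℕ.+ (suc (suc j) ℕ.* c₂ ℕ.+ suc j ℕ.* c₁) ℕ.+ c₀ ℕ.+ (suc j ℕ.* c₁ ℕ.+ j ℕ.* c₀)
    regroup = ℕ-Solver.solve-∀
    factor : ∀ n c₀ c₁ → c₁ ℕ.+ n ℕ.* c₁ ℕ.+ c₀ ℕ.+ n ℕ.* c₀ ≡ suc n ℕ.* (c₀ ℕ.+ c₁)
    factor = ℕ-Solver.solve-∀

  C-absorption : ∀ n j → (1ℤ + + j) * + (n C suc j) ≡ (+ n - + j) * + (n C j)
  C-absorption n j = begin
    (1ℤ + + j) * c₁                        ≡⟨ addSub ((1ℤ + + j) * c₁) (+ j * c₀) ⟩
    (1ℤ + + j) * c₁ + + j * c₀ - + j * c₀  ≡⟨ cong (_- + j * c₀) absorbed ⟩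
    + n * c₀ - + j * c₀                    ≡⟨ factorOut (+ n) (+ j) c₀ ⟩
    (+ n - + j) * c₀                       ∎
    where
    open ≡-Reasoning
    c₀ = + (n C j)
    c₁ = + (n C suc j)
    addSub : ∀ a b → a ≡ a + b - b
    addSub = solve-∀
    factorOut : ∀ n j c → n * c - j * c ≡ (n - j) * c
    factorOut = solve-∀
    absorbed : (1ℤ + + j) * c₁ + + j * c₀ ≡ + n * c₀
    absorbed = trans (cong₂ _+_ (sym (ℤP.pos-* (suc j) (n C suc j))) (sym (ℤP.pos-* j (n C j))))
               (trans (sym (ℤP.pos-+ (suc j ℕ.* (n C suc j)) (j ℕ.* (n C j))))
               (trans (cong +_ ([1+j]C[1+j]+jC n j)) (ℤP.pos-* n (n C j))))

  C-ratio : ∀ n i → (1ℤ + (1ℤ + + i)) * (+ n + 1ℤ) * + (n C suc (suc i))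
                    ≡ (+ n - (1ℤ + + i)) * (+ n + 1ℤ - (1ℤ + + i)) * + (suc n C suc i)
  C-ratio n i = begin
    (1ℤ + (1ℤ + + i)) * (+ n + 1ℤ) * c₂
      ≡⟨ reorder (1ℤ + (1ℤ + + i)) (+ n + 1ℤ) c₂ ⟩
    (+ n + 1ℤ) * ((1ℤ + (1ℤ + + i)) * c₂)
      ≡⟨ cong ((+ n + 1ℤ) *_) (C-absorption n (suc i)) ⟩
    (+ n + 1ℤ) * ((+ n - (1ℤ + + i)) * c₁)
      ≡⟨ split (+ n) (+ i) c₁ ⟩
    (+ n - (1ℤ + + i)) * ((1ℤ + + i) * c₁ + (+ n - + i) * c₁)
      ≡⟨ cong (λ z → (+ n - (1ℤ + + i)) * (z + (+ n - + i) * c₁)) (C-absorption n i) ⟩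
    (+ n - (1ℤ + + i)) * ((+ n - + i) * c₀ + (+ n - + i) * c₁)
      ≡⟨ collect (+ n) (+ i) c₀ c₁ ⟩
    (+ n - (1ℤ + + i)) * (+ n + 1ℤ - (1ℤ + + i)) * (c₀ + c₁)
      ≡⟨ cong ((+ n - (1ℤ + + i)) * (+ n + 1ℤ - (1ℤ + + i)) *_) (pascalℤ n i) ⟨
    (+ n - (1ℤ + + i)) * (+ n + 1ℤ - (1ℤ + + i)) * + (suc n C suc i) ∎
    where
    open ≡-Reasoning
    c₀ = + (n C i)
    c₁ = + (n C suc i)
    c₂ = + (n C suc (suc i))
    reorder : ∀ a b c → a * b * c ≡ b * (a * c)
    reorder = solve-∀
    split : ∀ n i c → (n + 1ℤ) * ((n - (1ℤ + i)) * c) ≡ (n - (1ℤ + i)) * ((1ℤ + i) * c + (n - i) * c)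
    split = solve-∀
    collect : ∀ n i c₀ c₁ → (n - (1ℤ + i)) * ((n - i) * c₀ + (n - i) * c₁)
                            ≡ (n - (1ℤ + i)) * (n + 1ℤ - (1ℤ + i)) * (c₀ + c₁)
    collect = solve-∀

  twice-nC2 : ∀ n → + 2 * + (n C 2) ≡ + n * + n - + n
  twice-nC2 zero    = refl
  twice-nC2 (suc n) = begin
    + 2 * + (suc n C 2)
      ≡⟨ cong (λ c → + 2 * + c) (nCk+nC[k+1]≡[n+1]C[k+1] n 1) ⟨
    + 2 * + (n C 1 ℕ.+ n C 2)
      ≡⟨ cong (λ c → + 2 * c) (trans (ℤP.pos-+ (n C 1) (n C 2)) (cong (λ c → + c + + (n C 2)) (nC1≡n n))) ⟩
    + 2 * (+ n + + (n C 2))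
      ≡⟨ ℤP.*-distribˡ-+ (+ 2) (+ n) (+ (n C 2)) ⟩
    + 2 * + n + + 2 * + (n C 2)
      ≡⟨ cong (λ c → + 2 * + n + c) (twice-nC2 n) ⟩
    + 2 * + n + (+ n * + n - + n)
      ≡⟨ square (+ n) ⟩
    (1ℤ + + n) * (1ℤ + + n) - (1ℤ + + n) ∎
    where
    open ≡-Reasoning
    square : ∀ n → + 2 * n + (n * n - n) ≡ (1ℤ + n) * (1ℤ + n) - (1ℤ + n)
    square = solve-∀

  module RecursionSum (K j : ℕ) where

    open EvenOddParts (suc K) j

    N : ℕ → ℕ
    N i = double (suc K ∸ i)

    N-suc : ∀ i → i ≤ K → N i ≡ suc (suc (N (suc i)))
    N-suc i i≤K = cong double (ℕP.+-∸-assoc 1 i≤K)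

    a d e : ℕ → ℤ
    a i = + (n C double i) * (+ (2 ℕ.^ (double i ∸ 1)) - 1ℤ)
    d i = + (2 ℕ.^ double i) * + (n C suc (double i))
    e i = + (n C double i)

    -- term is the summand of the recursion for P_(K+1): coefA = 6 a and coefB i = a (i + 1) − d i + e i.
    term R φ : ℕ → ℤ
    term i = + 6 * a i * xTimes (U (N i)) j + (a (suc i) - d i + e i) * U (N i) j
    R i    = a i * U⁺ (N i) j - d i * U (N i) j + e i * U (N i) j
    φ i    = a i * U (suc (suc (N i))) j

    -- Substituting 6x U_N = U_(N+1) − U_(N+2) makes the a-part telescope.
    term≡R+Δφ : ∀ i → i ≤ K → term i ≡ R i + (φ (suc i) - φ i)
    term≡R+Δφ i i≤K =
      trans (expand (a i) (a (suc i)) (d i) (e i) (xTimes (U (N i)) j) (U (N i) j) (U⁺ (N i) j))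
            (cong (λ m → R i + (a (suc i) * U m j - φ i)) (N-suc i i≤K))
      where expand : ∀ a a′ d e x u u⁺ → + 6 * a * x + (a′ - d + e) * u
                                         ≡ a * u⁺ - d * u + e * u + (a′ * u - a * (u⁺ - + 6 * x))
            expand = solve-∀

    sum-term : sum₁ K term ≡ sum₁ K R + (φ (suc K) - φ 1)
    sum-term = begin
      sum₁ K term                                ≡⟨ sum₁-cong K (λ i _ i≤K → term≡R+Δφ i i≤K) ⟩
      sum₁ K (λ i → R i + (φ (suc i) - φ i))     ≡⟨ sum₁-+ K R (λ i → φ (suc i) - φ i) ⟩
      sum₁ K R + sum₁ K (λ i → φ (suc i) - φ i)  ≡⟨ cong (λ z → sum₁ K R + z) (sum₁-telescope K φ) ⟩
      sum₁ K R + (φ (suc K) - φ 1)               ∎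
      where open ≡-Reasoning

    evenInterior oddInterior : ℤ → PolySeq → ℤ
    evenInterior c h = sum₁ K (λ i → + (n C double i) * c ^ double i * h (N i) j)
    oddInterior  c h = sum₁ K (λ i → + (n C suc (double i)) * c ^ suc (double i) * h (suc (N (suc i))) j)

    evenInterior≡ : ∀ c h → evenInterior c h ≡ evenPart c h - h n j - c ^ n * h 0 j
    evenInterior≡ c h = trans (isolate (h n j) (evenInterior c h) (c ^ n * h 0 j))
      (cong (λ z → + 1 * 1ℤ * h n j + (evenInterior c h + z) - h n j - c ^ n * h 0 j) (sym lastTerm))
      where
      lastTerm : + (n C n) * c ^ n * h (double (K ∸ K)) j ≡ c ^ n * h 0 j
      lastTerm rewrite nCn≡1 n | ℕP.n∸n≡0 K = trans (ℤP.*-assoc (+ 1) (c ^ n) (h 0 j)) (ℤP.*-identityˡ _)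
      isolate : ∀ x y z → y ≡ + 1 * 1ℤ * x + (y + z) - x - z
      isolate = solve-∀

    oddInterior≡ : ∀ c h → oddInterior c h ≡ oddPart c h - + n * c * h (suc (double K)) j
    oddInterior≡ c h = trans (isolate (+ n * c * h (suc (double K)) j) (oddInterior c h))
      (cong (_- + n * c * h (suc (double K)) j) (sym (trans (sum₁-peel K _)
        (cong (λ z → z * h (suc (double K)) j + oddInterior c h)
              (cong₂ _*_ (cong +_ (nC1≡n n)) (ℤP.*-identityʳ c))))))
      where isolate : ∀ x y → y ≡ x + y - x
            isolate = solve-∀

    twice-R : ∀ i → 0 < i → i ≤ K →
      + 2 * R i ≡ + (n C double i) * (+ 2) ^ double i * U⁺ (N i) j
                  - + 2 * (+ (n C double i) * 1ℤ ^ double i * U⁺ (N i) j)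
                  - + (n C suc (double i)) * (+ 2) ^ suc (double i) * U⁺ (suc (N (suc i))) j
                  + + 2 * (+ (n C double i) * 1ℤ ^ double i * U (N i) j)
    twice-R (suc i) _ i<K = begin
      + 2 * (a (suc i) * u⁺ - + (2 ℕ.* Q) * Cd * u + Cc * u)
        ≡⟨ cong (λ z → + 2 * (a (suc i) * u⁺ - z * Cd * u + Cc * u)) (ℤP.pos-* 2 Q) ⟩
      + 2 * (Cc * (+ Q - 1ℤ) * u⁺ - + 2 * + Q * Cd * u + Cc * u)
        ≡⟨ expand Cc Cd (+ Q) u⁺ u ⟩
      Cc * (+ 2 * + Q) * u⁺ - + 2 * (Cc * 1ℤ * u⁺) - Cd * (+ 2 * (+ 2 * + Q)) * u + + 2 * (Cc * 1ℤ * u)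
        ≡⟨ cong₂ (λ p o → Cc * p * u⁺ - + 2 * (Cc * o * u⁺) - Cd * (+ 2 * p) * u + + 2 * (Cc * o * u))
                 (trans (pos-^ 2 (double (suc i))) (ℤP.pos-* 2 Q)) (ℤP.^-zeroˡ (double (suc i))) ⟨
      Cc * (+ 2) ^ double (suc i) * u⁺ - + 2 * (Cc * 1ℤ ^ double (suc i) * u⁺)
        - Cd * (+ 2) ^ suc (double (suc i)) * u + + 2 * (Cc * 1ℤ ^ double (suc i) * u)
        ≡⟨ cong (λ m → Cc * (+ 2) ^ double (suc i) * u⁺ - + 2 * (Cc * 1ℤ ^ double (suc i) * u⁺)
                       - Cd * (+ 2) ^ suc (double (suc i)) * U m j + + 2 * (Cc * 1ℤ ^ double (suc i) * u))
                (N-suc (suc i) i<K) ⟩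
      Cc * (+ 2) ^ double (suc i) * u⁺ - + 2 * (Cc * 1ℤ ^ double (suc i) * u⁺)
        - Cd * (+ 2) ^ suc (double (suc i)) * U⁺ (suc (N (suc (suc i)))) j
        + + 2 * (Cc * 1ℤ ^ double (suc i) * u) ∎
      where
      open ≡-Reasoning
      Q = 2 ℕ.^ suc (double i)
      Cc = + (n C double (suc i))
      Cd = + (n C suc (double (suc i)))
      u⁺ = U⁺ (N (suc i)) j
      u = U (N (suc i)) j
      expand : ∀ Cc Cd Q u⁺ u → + 2 * (Cc * (Q - 1ℤ) * u⁺ - + 2 * Q * Cd * u + Cc * u)
                                ≡ Cc * (+ 2 * Q) * u⁺ - + 2 * (Cc * 1ℤ * u⁺) - Cd * (+ 2 * (+ 2 * Q)) * u + + 2 * (Cc * 1ℤ * u)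
      expand = solve-∀

    twice-sum-R : + 2 * sum₁ K R ≡ evenInterior (+ 2) U⁺ - + 2 * evenInterior 1ℤ U⁺
                                   - oddInterior (+ 2) U⁺ + + 2 * evenInterior 1ℤ U
    twice-sum-R = begin
      + 2 * sum₁ K R
        ≡⟨ sum₁-* K (+ 2) R ⟨
      sum₁ K (λ i → + 2 * R i)
        ≡⟨ sum₁-cong K twice-R ⟩
      sum₁ K (λ i → A i - + 2 * B i - D i + + 2 * E i)
        ≡⟨ sum₁-+ K (λ i → A i - + 2 * B i - D i) (λ i → + 2 * E i) ⟩
      sum₁ K (λ i → A i - + 2 * B i - D i) + sum₁ K (λ i → + 2 * E i)
        ≡⟨ cong₂ _+_ (sum₁-- K (λ i → A i - + 2 * B i) D) (sum₁-* K (+ 2) E) ⟩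
      sum₁ K (λ i → A i - + 2 * B i) - sum₁ K D + + 2 * sum₁ K E
        ≡⟨ cong (λ z → z - sum₁ K D + + 2 * sum₁ K E)
                (trans (sum₁-- K A (λ i → + 2 * B i)) (cong (λ z → sum₁ K A - z) (sum₁-* K (+ 2) B))) ⟩
      sum₁ K A - + 2 * sum₁ K B - sum₁ K D + + 2 * sum₁ K E ∎
      where
      open ≡-Reasoning
      A B D E : ℕ → ℤ
      A i = + (n C double i) * (+ 2) ^ double i * U⁺ (N i) j
      B i = + (n C double i) * 1ℤ ^ double i * U⁺ (N i) j
      D i = + (n C suc (double i)) * (+ 2) ^ suc (double i) * U⁺ (suc (N (suc i))) j
      E i = + (n C double i) * 1ℤ ^ double i * U (N i) j

    twice-sum-R-closed : + 2 * sum₁ K R ≡ + 2 * (+ n - 1ℤ) * U n j - ((+ 2) ^ n - + 2) * U 1 j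
    twice-sum-R-closed = begin
      + 2 * sum₁ K R
        ≡⟨ twice-sum-R ⟩
      evenInterior (+ 2) U⁺ - + 2 * evenInterior 1ℤ U⁺ - oddInterior (+ 2) U⁺ + + 2 * evenInterior 1ℤ U
        ≡⟨ cong₂ (λ x y → x - + 2 * y - oddInterior (+ 2) U⁺ + + 2 * evenInterior 1ℤ U)
                 (evenInterior≡ (+ 2) U⁺) (evenInterior≡ 1ℤ U⁺) ⟩
      E₂⁺ - u⁺ - p * δ - + 2 * (E₁⁺ - u⁺ - 1ℤ ^ n * δ) - oddInterior (+ 2) U⁺ + + 2 * evenInterior 1ℤ U
        ≡⟨ cong₂ (λ x y → E₂⁺ - u⁺ - p * δ - + 2 * (E₁⁺ - u⁺ - 1ℤ ^ n * δ) - x + + 2 * y)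
                 (oddInterior≡ (+ 2) U⁺) (evenInterior≡ 1ℤ U) ⟩
      E₂⁺ - u⁺ - p * δ - + 2 * (E₁⁺ - u⁺ - 1ℤ ^ n * δ) - (O₂⁺ - + n * + 2 * u) + + 2 * (E₁ - u - 1ℤ ^ n * 0ℤ)
        ≡⟨ cong₂ (λ x o → x - u⁺ - p * δ - + 2 * (E₁⁺ - u⁺ - o * δ) - (O₂⁺ - + n * + 2 * u) + + 2 * (E₁ - u - o * 0ℤ))
                 evenPart-2-U⁺ (ℤP.^-zeroˡ n) ⟩
      E₁⁺ + O₁⁺ + O₂⁺ - (E₁ + O₁) - u⁺ - p * δ - + 2 * (E₁⁺ - u⁺ - 1ℤ * δ)
        - (O₂⁺ - + n * + 2 * u) + + 2 * (E₁ - u - 1ℤ * 0ℤ)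
        ≡⟨ cong₂ (λ x y → E₁⁺ + x + O₂⁺ - (E₁ + y) - u⁺ - p * δ - + 2 * (E₁⁺ - u⁺ - 1ℤ * δ)
                          - (O₂⁺ - + n * + 2 * u) + + 2 * (E₁ - u - 1ℤ * 0ℤ))
                 oddPart-U⁺ oddPart-U ⟩
      E₁⁺ + (E₁⁺ - (u⁺ - u)) + O₂⁺ - (E₁ + (E₁ - - u)) - u⁺ - p * δ - + 2 * (E₁⁺ - u⁺ - 1ℤ * δ)
        - (O₂⁺ - + n * + 2 * u) + + 2 * (E₁ - u - 1ℤ * 0ℤ)
        ≡⟨ algebra E₁⁺ E₁ O₂⁺ u⁺ u δ p (+ n) ⟩
      + 2 * (+ n - 1ℤ) * u - (p - + 2) * δ ∎
      where
      open ≡-Reasoning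
      E₂⁺ = evenPart (+ 2) U⁺
      E₁⁺ = evenPart 1ℤ U⁺
      E₁  = evenPart 1ℤ U
      O₂⁺ = oddPart (+ 2) U⁺
      O₁⁺ = oddPart 1ℤ U⁺
      O₁  = oddPart 1ℤ U
      u⁺ = U⁺ n j
      u  = U n j
      δ  = U 1 j
      p  = (+ 2) ^ n
      algebra : ∀ e⁺ e o u⁺ u δ p m →
        e⁺ + (e⁺ - (u⁺ - u)) + o - (e + (e - - u)) - u⁺ - p * δ - + 2 * (e⁺ - u⁺ - 1ℤ * δ)
          - (o - m * + 2 * u) + + 2 * (e - u - 1ℤ * 0ℤ)
        ≡ + 2 * (m - 1ℤ) * u - (p - + 2) * δ
      algebra = solve-∀

    φ-last : φ (suc K) ≡ + 1 * (+ (2 ℕ.^ suc (double K)) - 1ℤ) * U 1 j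
    φ-last = cong₂ (λ c u → + c * (+ (2 ℕ.^ suc (double K)) - 1ℤ) * u) (nCn≡1 n)
                   (trans (cong (λ m → U (suc (suc (double m))) j) (ℕP.n∸n≡0 K)) (U-2 j))

    recursion-sum : sum₁ K term ≡ - ((+ 2 * + K + 1ℤ) * + K) * U n j
    recursion-sum = ℤP.*-cancelˡ-≡ (+ 2) _ _ (begin
      + 2 * sum₁ K term
        ≡⟨ cong (λ s → + 2 * s) sum-term ⟩
      + 2 * (sum₁ K R + (φ (suc K) - φ 1))
        ≡⟨ ℤP.*-distribˡ-+ (+ 2) (sum₁ K R) (φ (suc K) - φ 1) ⟩
      + 2 * sum₁ K R + + 2 * (φ (suc K) - φ 1)
        ≡⟨ cong₂ (λ s φₖ → s + + 2 * (φₖ - φ 1)) twice-sum-R-closed φ-last ⟩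
      + 2 * (+ n - 1ℤ) * u - ((+ 2) ^ n - + 2) * δ + + 2 * (+ 1 * (+ Q - 1ℤ) * δ - + (n C 2) * (+ 2 - 1ℤ) * u)
        ≡⟨ cong (λ p → + 2 * (+ n - 1ℤ) * u - (+ 2 * p - + 2) * δ + + 2 * (+ 1 * (+ Q - 1ℤ) * δ - + (n C 2) * (+ 2 - 1ℤ) * u))
                (pos-^ 2 (suc (double K))) ⟩
      + 2 * (+ n - 1ℤ) * u - (+ 2 * + Q - + 2) * δ + + 2 * (+ 1 * (+ Q - 1ℤ) * δ - + (n C 2) * (+ 2 - 1ℤ) * u)
        ≡⟨ cancelδ (+ n) u δ (+ Q) (+ (n C 2)) ⟩
      + 2 * (+ n - 1ℤ) * u - (+ 2 * + (n C 2)) * u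
        ≡⟨ cong (λ c → + 2 * (+ n - 1ℤ) * u - c * u) (twice-nC2 n) ⟩
      + 2 * (+ n - 1ℤ) * u - (+ n * + n - + n) * u
        ≡⟨ cong (λ m → + 2 * (m - 1ℤ) * u - (m * m - m) * u) (pos-double (suc K)) ⟩
      + 2 * (+ 2 * (1ℤ + + K) - 1ℤ) * u - (+ 2 * (1ℤ + + K) * (+ 2 * (1ℤ + + K)) - + 2 * (1ℤ + + K)) * u
        ≡⟨ factor (+ K) u ⟩
      + 2 * (- ((+ 2 * + K + 1ℤ) * + K) * u) ∎)
      where
      open ≡-Reasoning
      Q = 2 ℕ.^ suc (double K)
      u = U n j
      δ = U 1 j
      cancelδ : ∀ m u δ q c → + 2 * (m - 1ℤ) * u - (+ 2 * q - + 2) * δ + + 2 * (+ 1 * (q - 1ℤ) * δ - c * (+ 2 - 1ℤ) * u)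
                              ≡ + 2 * (m - 1ℤ) * u - (+ 2 * c) * u
      cancelδ = solve-∀
      factor : ∀ k u → + 2 * (+ 2 * (1ℤ + k) - 1ℤ) * u - (+ 2 * (1ℤ + k) * (+ 2 * (1ℤ + k)) - + 2 * (1ℤ + k)) * u
                       ≡ + 2 * (- ((+ 2 * k + 1ℤ) * k) * u)
      factor = solve-∀

  -- Integrality of P_k

  toℚᵘ-/1 : ∀ a → ℚ.toℚᵘ (a ℚ./ 1) ℚᵘ.≃ mkℚᵘ a 0
  toℚᵘ-/1 a = ℚP.toℚᵘ-fromℚᵘ (mkℚᵘ a 0)

  /1-+ : ∀ a b → (a ℚ./ 1) ℚ.+ (b ℚ./ 1) ≡ (a + b) ℚ./ 1
  /1-+ a b = ℚP.toℚᵘ-injective (ℚᵘP.≃-trans (ℚP.toℚᵘ-homo-+ (a ℚ./ 1) (b ℚ./ 1))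
    (ℚᵘP.≃-trans (ℚᵘP.+-cong (toℚᵘ-/1 a) (toℚᵘ-/1 b))
    (ℚᵘP.≃-trans (*≡* (crossMultiply a b)) (ℚᵘP.≃-sym (toℚᵘ-/1 (a + b))))))
    where crossMultiply : ∀ a b → (a * + 1 + b * + 1) * + 1 ≡ (a + b) * + 1
          crossMultiply = solve-∀

  /1-* : ∀ a b → (a ℚ./ 1) ℚ.* (b ℚ./ 1) ≡ (a * b) ℚ./ 1
  /1-* a b = ℚP.toℚᵘ-injective (ℚᵘP.≃-trans (ℚP.toℚᵘ-homo-* (a ℚ./ 1) (b ℚ./ 1))
    (ℚᵘP.≃-trans (ℚᵘP.*-cong (toℚᵘ-/1 a) (toℚᵘ-/1 b)) (ℚᵘP.≃-sym (toℚᵘ-/1 (a * b)))))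

  -[1/d]*[-d*z]≡z : ∀ t z → ℚ.- ((+ 1) ℚ./ suc t) ℚ.* ((- (+ suc t) * z) ℚ./ 1) ≡ z ℚ./ 1
  -[1/d]*[-d*z]≡z t z = ℚP.toℚᵘ-injective
    (ℚᵘP.≃-trans (ℚP.toℚᵘ-homo-* (ℚ.- ((+ 1) ℚ./ suc t)) ((- (+ suc t) * z) ℚ./ 1))
    (ℚᵘP.≃-trans (ℚᵘP.*-cong (ℚᵘP.≃-trans (ℚP.toℚᵘ-homo‿- ((+ 1) ℚ./ suc t))
                                          (ℚᵘP.-‿cong (ℚP.toℚᵘ-fromℚᵘ (mkℚᵘ (+ 1) t))))
                             (toℚᵘ-/1 (- (+ suc t) * z)))
    (ℚᵘP.≃-trans (*≡* (crossMultiply (+ suc t) z)) (ℚᵘP.≃-sym (toℚᵘ-/1 z)))))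
    where crossMultiply : ∀ d z → (- (+ 1) * (- d * z)) * + 1 ≡ z * (d * + 1)
          crossMultiply = solve-∀

  sum1ℚ-/1 : ∀ N (f : ℕ → ℚ) (g : ℕ → ℤ) → (∀ i → 0 < i → i ≤ N → f i ≡ g i ℚ./ 1) →
             sum1ℚ N f ≡ sum₁ N g ℚ./ 1
  sum1ℚ-/1 zero    f g f≡g = refl
  sum1ℚ-/1 (suc N) f g f≡g =
    trans (cong₂ ℚ._+_ (sum1ℚ-/1 N f g λ i 0<i i≤N → f≡g i 0<i (ℕP.m≤n⇒m≤1+n i≤N))
                       (f≡g (suc N) (s≤s z≤n) ℕP.≤-refl))
          (/1-+ (sum₁ N g) (g (suc N)))

  xTimesQ-/1 : ∀ (p : QPoly) (h : ZPoly) → (∀ j → p j ≡ h j ℚ./ 1) → ∀ j → xTimesQ p j ≡ xTimes h j ℚ./ 1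
  xTimesQ-/1 p h p≡h zero    = refl
  xTimesQ-/1 p h p≡h (suc j) = p≡h j

  table-suc : ∀ n → table (suc n) (suc n) ≡ newP (suc n) (table n)
  table-suc n with suc n ≟ suc n
  ... | yes _   = refl
  ... | no  n≢n = ⊥-elim (n≢n refl)

  table≡P : ∀ n m → m ≤ n → table n m ≡ P m
  table≡P zero    zero z≤n = refl
  table≡P (suc n) m m≤n with m ≟ suc n
  ... | yes refl = sym (table-suc n)
  ... | no  m≢n  = table≡P n m (ℕP.≤-pred (ℕP.≤∧≢⇒< m≤n m≢n))

  coefA≡ : ∀ K j i → coefA (suc K) i ≡ + 6 * RecursionSum.a K j i
  coefA≡ K j i rewrite sym (double≡2* (suc K)) | sym (double≡2* i) =
    ℤP.*-assoc (+ 6) (+ (double (suc K) C double i)) (+ (2 ℕ.^ (double i ∸ 1)) - 1ℤ)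

  coefB≡ : ∀ K j i → coefB (suc K) i ≡ RecursionSum.a K j (suc i) - RecursionSum.d K j i + RecursionSum.e K j i
  coefB≡ K j i rewrite sym (double≡2* (suc K)) | sym (double≡2* i)
                     | ℕP.+-comm (double i) 2 | ℕP.+-comm (double i) 1 = refl

  denominator≡ : ∀ m → (+ 2 * + suc m + 1ℤ) * + suc m ≡ + ((3 ℕ.+ 2 ℕ.* m) ℕ.* suc m)
  denominator≡ m = begin
    (+ 2 * (1ℤ + + m) + 1ℤ) * (1ℤ + + m)  ≡⟨ expand (+ m) ⟩
    (+ 3 + + 2 * + m) * (1ℤ + + m)        ≡⟨ cong (λ c → (+ 3 + c) * + suc m) (ℤP.pos-* 2 m) ⟨
    + (3 ℕ.+ 2 ℕ.* m) * + suc m           ≡⟨ ℤP.pos-* (3 ℕ.+ 2 ℕ.* m) (suc m) ⟨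
    + ((3 ℕ.+ 2 ℕ.* m) ℕ.* suc m)         ∎
    where
    open ≡-Reasoning
    expand : ∀ m → (+ 2 * (1ℤ + m) + 1ℤ) * (1ℤ + m) ≡ (+ 3 + + 2 * m) * (1ℤ + m)
    expand = solve-∀

  stepP≡U : ∀ m (prev : ℕ → QPoly) →
            (∀ i → 0 < i → i ≤ suc m → ∀ j → prev (suc (suc m) ∸ i) j ≡ U (double (suc (suc m) ∸ i)) j ℚ./ 1) →
            ∀ j → stepP m prev j ≡ U (double (suc (suc m))) j ℚ./ 1
  stepP≡U m prev earlier j = begin
    -1/d ℚ.* sum1ℚ (suc m) summand
      ≡⟨ cong (-1/d ℚ.*_) (sum1ℚ-/1 (suc m) summand term summand≡) ⟩
    -1/d ℚ.* (sum₁ (suc m) term ℚ./ 1)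
      ≡⟨ cong (λ s → -1/d ℚ.* (s ℚ./ 1)) (trans recursion-sum (cong (λ d → - d * U (double k) j) (denominator≡ m))) ⟩
    -1/d ℚ.* ((- (+ ((3 ℕ.+ 2 ℕ.* m) ℕ.* suc m)) * U (double k) j) ℚ./ 1)
      ≡⟨ -[1/d]*[-d*z]≡z (m ℕ.+ (2 ℕ.+ 2 ℕ.* m) ℕ.* suc m) (U (double k) j) ⟩
    U (double k) j ℚ./ 1 ∎
    where
    open ≡-Reasoning
    open RecursionSum (suc m) j using (term; recursion-sum)
    k = suc (suc m)
    -1/d = ℚ.- ((+ 1) ℚ./ ((3 ℕ.+ 2 ℕ.* m) ℕ.* suc m))
    summand : ℕ → ℚ
    summand i = (coefA k i ℚ./ 1) ℚ.* xTimesQ (prev (k ∸ i)) j ℚ.+ (coefB k i ℚ./ 1) ℚ.* prev (k ∸ i) j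
    summand≡ : ∀ i → 0 < i → i ≤ suc m → summand i ≡ term i ℚ./ 1
    summand≡ i 0<i i≤m = begin
      summand i
        ≡⟨ cong₂ (λ x u → (coefA k i ℚ./ 1) ℚ.* x ℚ.+ (coefB k i ℚ./ 1) ℚ.* u)
                 (xTimesQ-/1 _ _ (earlier i 0<i i≤m) j) (earlier i 0<i i≤m j) ⟩
      (coefA k i ℚ./ 1) ℚ.* (x ℚ./ 1) ℚ.+ (coefB k i ℚ./ 1) ℚ.* (u ℚ./ 1)
        ≡⟨ cong₂ ℚ._+_ (/1-* (coefA k i) x) (/1-* (coefB k i) u) ⟩
      ((coefA k i * x) ℚ./ 1) ℚ.+ ((coefB k i * u) ℚ./ 1)
        ≡⟨ /1-+ (coefA k i * x) (coefB k i * u) ⟩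
      (coefA k i * x + coefB k i * u) ℚ./ 1
        ≡⟨ cong₂ (λ α β → (α * x + β * u) ℚ./ 1) (coefA≡ (suc m) j i) (coefB≡ (suc m) j i) ⟩
      term i ℚ./ 1 ∎
      where
      u = U (double (k ∸ i)) j
      x = xTimes (U (double (k ∸ i))) j

  P≡U : ∀ k j → P k j ≡ U (double k) j ℚ./ 1
  P≡U = <-rec (λ k → ∀ j → P k j ≡ U (double k) j ℚ./ 1) fromEarlier
    where
    fromEarlier : ∀ k → (∀ {m} → m < k → ∀ j → P m j ≡ U (double m) j ℚ./ 1) → ∀ j → P k j ≡ U (double k) j ℚ./ 1
    fromEarlier zero            _  j       = refl
    fromEarlier (suc zero)      _  zero    = refl
    fromEarlier (suc zero)      _  (suc j) = refl
    fromEarlier (suc (suc m))   ih j       = trans (cong (λ p → p j) (table-suc (suc m))) (stepP≡U m (table (suc m)) earlier j)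
      where
      earlier : ∀ i → 0 < i → i ≤ suc m → ∀ j → table (suc m) (suc (suc m) ∸ i) j ≡ U (double (suc (suc m) ∸ i)) j ℚ./ 1
      earlier (suc i) _ _ j = trans (cong (λ p → p j) (table≡P (suc m) (suc m ∸ i) (ℕP.m∸n≤m (suc m) i)))
                                    (ih (s≤s (ℕP.m∸n≤m (suc m) i)) j)

  -- Closed forms and the congruence modulo ℓ

  U-closed : ∀ m j → U (suc m) j ≡ (- + 6) ^ j * + ((m ∸ j) C j)
  U-closed zero          zero          = refl
  U-closed zero          (suc j)       = sym (ℤP.*-zeroʳ ((- + 6) ^ suc j))
  U-closed (suc zero)    zero          = refl
  U-closed (suc zero)    (suc zero)    = refl
  U-closed (suc zero)    (suc (suc j)) = sym (ℤP.*-zeroʳ ((- + 6) ^ suc (suc j)))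
  U-closed (suc (suc m)) zero          rewrite U-closed (suc m) zero = refl
  U-closed (suc (suc m)) (suc j)       rewrite U-closed (suc m) (suc j) | U-closed m j =
    trans (factor ((- + 6) ^ j) (+ ((m ∸ j) C suc j)) (+ ((m ∸ j) C j)))
          (cong ((- + 6) ^ suc j *_) (sym pascal))
    where
    factor : ∀ p a b → - + 6 * p * a - + 6 * (p * b) ≡ - + 6 * p * (a + b)
    factor = solve-∀
    pascal : + ((suc m ∸ j) C suc j) ≡ + ((m ∸ j) C suc j) + + ((m ∸ j) C j)
    pascal with j ℕ.≤? m
    ... | yes j≤m = trans (cong (λ n → + (n C suc j)) (ℕP.+-∸-assoc 1 j≤m))
                          (trans (pascalℤ (m ∸ j) j) (ℤP.+-comm (+ ((m ∸ j) C j)) (+ ((m ∸ j) C suc j))))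
    ... | no  j≰m with ℕP.≰⇒> j≰m
    ...   | s≤s m≤j′ rewrite ℕP.m≤n⇒m∸n≡0 m≤j′ | ℕP.m≤n⇒m∸n≡0 (ℕP.m≤n⇒m≤1+n m≤j′) = refl

  constZ-*Z : ∀ c (q : ZPoly) j → (constZ c *Z q) j ≡ c * q j
  constZ-*Z c q j = onlyFirst j
    where
    onlyFirst : ∀ N → sum0ℤ N (λ i → constZ c i * q (j ∸ i)) ≡ c * q j
    onlyFirst zero    = refl
    onlyFirst (suc N) = trans (cong₂ _+_ (onlyFirst N) (ℤP.*-zeroˡ (q (j ∸ suc N)))) (ℤP.+-identityʳ _)

  1-24x : ZPoly
  1-24x = oneZ -Z (constZ (+ 24) *Z xZ)

  1-24x-*Z : ∀ q j → (1-24x *Z q) j ≡ q j - + 24 * xTimes q j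
  1-24x-*Z q zero    = trans (ℤP.*-identityˡ (q 0)) (sym (ℤP.+-identityʳ (q 0)))
  1-24x-*Z q (suc j) = lowTerms j
    where
    1-24x-high : ∀ i → 1-24x (suc (suc i)) ≡ 0ℤ
    1-24x-high i = cong (λ z → + 0 - z) (constZ-*Z (+ 24) xZ (suc (suc i)))
    lowTerms : ∀ N → sum0ℤ (suc N) (λ i → 1-24x i * q (suc j ∸ i)) ≡ q (suc j) - + 24 * q j
    lowTerms zero    = simplify (q (suc j)) (q j)
      where simplify : ∀ a b → 1ℤ * a + - + 24 * b ≡ a - + 24 * b
            simplify = solve-∀
    lowTerms (suc N) = trans (cong₂ (λ s c → s + c * q (suc j ∸ suc (suc N))) (lowTerms N) (1-24x-high N))
                             (ℤP.+-identityʳ _)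

  1-24x-^Z : ∀ M j → (1-24x ^Z M) j ≡ (- + 24) ^ j * + (M C j)
  1-24x-^Z zero    zero    = refl
  1-24x-^Z zero    (suc j) = sym (ℤP.*-zeroʳ ((- + 24) ^ suc j))
  1-24x-^Z (suc M) zero    = trans (1-24x-*Z (1-24x ^Z M) zero) (cong (_- + 24 * 0ℤ) (1-24x-^Z M zero))
  1-24x-^Z (suc M) (suc j) = begin
    (1-24x *Z (1-24x ^Z M)) (suc j)
      ≡⟨ 1-24x-*Z (1-24x ^Z M) (suc j) ⟩
    (1-24x ^Z M) (suc j) - + 24 * (1-24x ^Z M) j
      ≡⟨ cong₂ (λ u v → u - + 24 * v) (1-24x-^Z M (suc j)) (1-24x-^Z M j) ⟩
    (- + 24) ^ suc j * + (M C suc j) - + 24 * ((- + 24) ^ j * + (M C j))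
      ≡⟨ factor ((- + 24) ^ j) (+ (M C suc j)) (+ (M C j)) ⟩
    (- + 24) ^ suc j * (+ (M C j) + + (M C suc j))
      ≡⟨ cong ((- + 24) ^ suc j *_) (pascalℤ M j) ⟨
    (- + 24) ^ suc j * + (suc M C suc j) ∎
    where
    open ≡-Reasoning
    factor : ∀ p a b → - + 24 * p * a - + 24 * (p * b) ≡ - + 24 * p * (b + a)
    factor = solve-∀

  RHS-closed : ∀ ℓ j → RHS ℓ j ≡ + ((ℓ ℕ.+ 1) ℕ./ 2) * (oneZ j + (- + 24) ^ j * + (((ℓ ∸ 1) ℕ./ 2) C j))
  RHS-closed ℓ j = trans (constZ-*Z (+ ((ℓ ℕ.+ 1) ℕ./ 2)) (oneZ +Z (1-24x ^Z ((ℓ ∸ 1) ℕ./ 2))) j) (cong (λ z → + ((ℓ ℕ.+ 1) ℕ./ 2) * (oneZ j + z)) (1-24x-^Z _ j))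

  ∣c*x⇒∣x : ∀ {p} → Prime p → ∀ c x → 0 < c → c < p → + p ℤ∣.∣ + c * x → + p ℤ∣.∣ x
  ∣c*x⇒∣x {p} p-prime c x 0<c c<p p∣cx
    with euclidsLemma c ℤ.∣ x ∣ p-prime (subst (p ℕ∣.∣_) (ℤP.abs-* (+ c) x) (ℤ∣.∣⇒∣ᵤ p∣cx))
  ... | inj₂ p∣x = ℤ∣.∣ᵤ⇒∣ p∣x
  ... | inj₁ p∣c = ⊥-elim (ℕP.<⇒≱ c<p (ℕ∣.∣⇒≤ {{ℕ.>-nonZero 0<c}} p∣c))

  even-or-odd : ∀ n → (∃ λ M → n ≡ double M) ⊎ (∃ λ M → n ≡ suc (double M))
  even-or-odd zero    = inj₁ (0 , refl)
  even-or-odd (suc n) with even-or-odd n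
  ... | inj₁ (M , n≡2M)   = inj₂ (M , cong suc n≡2M)
  ... | inj₂ (M , n≡2M+1) = inj₁ (suc M , cong suc n≡2M+1)

  prime>2⇒odd : ∀ ℓ → Prime ℓ → 2 < ℓ → ∃ λ M → ℓ ≡ suc (double M)
  prime>2⇒odd ℓ ℓ-prime 2<ℓ with even-or-odd ℓ
  ... | inj₂ ℓ-odd      = ℓ-odd
  ... | inj₁ (M , ℓ≡2M) = ⊥-elim (prime⇒¬composite ℓ-prime
                                    (composite-≢ 2 {{_}} {{prime⇒nonZero ℓ-prime}} (ℕP.<⇒≢ 2<ℓ) 2∣ℓ))
    where 2∣ℓ : 2 ℕ∣.∣ ℓ
          2∣ℓ = ℕ∣.divides M (trans ℓ≡2M (trans (double≡2* M) (ℕP.*-comm 2 M)))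

  module Congruence (M : ℕ) (ℓ-prime : Prime (suc (double M))) where

    ℓ : ℕ
    ℓ = suc (double M)

    ℓ≡2M+1 : + ℓ ≡ + 2 * + M + 1ℤ
    ℓ≡2M+1 = trans (ℤP.+-comm 1ℤ (+ double M)) (cong (_+ 1ℤ) (pos-double M))

    Dif : ℕ → ℤ
    Dif j = + 2 * + ((ℓ ∸ j) C j) - (+ 4) ^ j * + (M C j)

    Dif-1 : Dif 1 ≡ 0ℤ
    Dif-1 = begin
      + 2 * + (double M C 1) - (+ 4 * 1ℤ) * + (M C 1)
        ≡⟨ cong₂ (λ u v → + 2 * + u - (+ 4 * 1ℤ) * + v) (nC1≡n (double M)) (nC1≡n M) ⟩
      + 2 * + double M - (+ 4 * 1ℤ) * + M
        ≡⟨ cong (λ u → + 2 * u - (+ 4 * 1ℤ) * + M) (pos-double M) ⟩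
      + 2 * (+ 2 * + M) - (+ 4 * 1ℤ) * + M
        ≡⟨ cancel (+ M) ⟩
      0ℤ ∎
      where
      open ≡-Reasoning
      cancel : ∀ m → + 2 * (+ 2 * m) - (+ 4 * 1ℤ) * m ≡ 0ℤ
      cancel = solve-∀

    -- Modulo ℓ, increasing j multiplies both C(ℓ − j, j) and 4^j C(M, j) by −2(2j + 1)/(j + 1),
    -- because ℓ ≡ 0 and M ≡ −1/2.
    Dif-recurrence : ∀ J → 0 < J → suc J ≤ M →
                     + ℓ ℤ∣.∣ + J * (+ suc J * Dif (suc J)) + + 2 * + J * (+ 2 * + J + 1ℤ) * Dif J
    Dif-recurrence J@(suc i) _ J<M = ℤ∣.divides W (begin
      + J * (+ suc J * Dif (suc J)) + + 2 * + J * (+ 2 * + J + 1ℤ) * Dif J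
        ≡⟨ cong (λ d → + J * (+ suc J * Dif (suc J)) + + 2 * + J * (+ 2 * + J + 1ℤ) * d) Dif-J ⟩
      + J * (+ suc J * (+ 2 * a₁ - (+ 4 * q) * b₁)) + + 2 * + J * (+ 2 * + J + 1ℤ) * (+ 2 * a₀ - q * b₀)
        ≡⟨ identity (+ M) (+ J) a₁ a₀ b₁ b₀ q ⟩
      W * (+ 2 * + M + 1ℤ) + (- + 2) * (ratioₐˡ - ratioₐʳ) + (- + 4 * + J * q) * (ratio_bˡ - ratio_bʳ)
        ≡⟨ cong₂ (λ u v → W * (+ 2 * + M + 1ℤ) + (- + 2) * (u - ratioₐʳ) + (- + 4 * + J * q) * (v - ratio_bʳ))
                 ratioₐ ratio_b ⟩
      W * (+ 2 * + M + 1ℤ) + (- + 2) * (ratioₐʳ - ratioₐʳ) + (- + 4 * + J * q) * (ratio_bʳ - ratio_bʳ)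
        ≡⟨ vanish (W * (+ 2 * + M + 1ℤ)) ratioₐʳ ratio_bʳ (- + 4 * + J * q) ⟩
      W * (+ 2 * + M + 1ℤ)
        ≡⟨ cong (W *_) ℓ≡2M+1 ⟨
      W * + ℓ ∎)
      where
      open ≡-Reasoning
      J≤2M : J ≤ double M
      J≤2M = ℕP.≤-trans (ℕP.<⇒≤ J<M) (subst (M ≤_) (sym (double≡2* M)) (ℕP.m≤m+n M (M ℕ.+ 0)))
      n = double M ∸ J
      a₁ = + (n C suc J)
      a₀ = + (suc n C J)
      b₁ = + (M C suc J)
      b₀ = + (M C J)
      q = (+ 4) ^ J
      W = + 2 * (+ J + 1ℤ) * a₁ - + 2 * (+ 2 * + M + 1ℤ - + 4 * + J - 1ℤ) * a₀ - + 2 * + J * q * b₀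
      Dif-J : Dif J ≡ + 2 * a₀ - q * b₀
      Dif-J = cong (λ m → + 2 * + (m C J) - q * b₀) (ℕP.+-∸-assoc 1 J≤2M)
      n≡2M-J : + n ≡ + 2 * + M - + J
      n≡2M-J = begin
        + n                      ≡⟨ addSub (+ n) (+ J) ⟩
        + n + + J - + J          ≡⟨ cong (_- + J) (ℤP.pos-+ n J) ⟨
        + (n ℕ.+ J) - + J        ≡⟨ cong (λ m → + m - + J) (ℕP.m∸n+n≡m J≤2M) ⟩
        + double M - + J         ≡⟨ cong (_- + J) (pos-double M) ⟩
        + 2 * + M - + J          ∎
        where addSub : ∀ a b → a ≡ a + b - b
              addSub = solve-∀
      ratioₐˡ ratioₐʳ ratio_bˡ ratio_bʳ : ℤ
      ratioₐˡ = (+ J + 1ℤ) * (+ 2 * + M - + J + 1ℤ) * a₁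
      ratioₐʳ = (+ 2 * + M - + J - + J) * (+ 2 * + M - + J + 1ℤ - + J) * a₀
      ratio_bˡ = (1ℤ + + J) * b₁
      ratio_bʳ = (+ M - + J) * b₀
      ratioₐ : ratioₐˡ ≡ ratioₐʳ
      ratioₐ = trans (cong (λ z → z * (+ 2 * + M - + J + 1ℤ) * a₁) (ℤP.+-comm (+ J) 1ℤ))
                     (subst (λ z → (1ℤ + + J) * (z + 1ℤ) * a₁ ≡ (z - + J) * (z + 1ℤ - + J) * a₀) n≡2M-J (C-ratio n i))
      ratio_b : ratio_bˡ ≡ ratio_bʳ
      ratio_b = C-absorption M J
      identity : ∀ m j a₁ a₀ b₁ b₀ q →
        j * ((1ℤ + j) * (+ 2 * a₁ - (+ 4 * q) * b₁)) + + 2 * j * (+ 2 * j + 1ℤ) * (+ 2 * a₀ - q * b₀)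
        ≡ (+ 2 * (j + 1ℤ) * a₁ - + 2 * (+ 2 * m + 1ℤ - + 4 * j - 1ℤ) * a₀ - + 2 * j * q * b₀) * (+ 2 * m + 1ℤ)
          + (- + 2) * ((j + 1ℤ) * (+ 2 * m - j + 1ℤ) * a₁ - (+ 2 * m - j - j) * (+ 2 * m - j + 1ℤ - j) * a₀)
          + (- + 4 * j * q) * ((1ℤ + j) * b₁ - (m - j) * b₀)
      identity = solve-∀
      vanish : ∀ x y z c → x + (- + 2) * (y - y) + c * (z - z) ≡ x
      vanish = solve-∀

    ℓ<2j : ∀ j → M < j → ℓ < j ℕ.+ j
    ℓ<2j j M<j = begin-strict
      suc (double M)       ≡⟨ cong suc (trans (double≡2* M) (cong (M ℕ.+_) (ℕP.+-identityʳ M))) ⟩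
      suc (M ℕ.+ M)        <⟨ s≤s (ℕP.+-monoʳ-< M (ℕP.n<1+n M)) ⟩
      suc M ℕ.+ suc M      ≤⟨ ℕP.+-mono-≤ M<j M<j ⟩
      j ℕ.+ j              ∎
      where open ℕP.≤-Reasoning

    Dif-vanishes : ∀ j → M < j → Dif j ≡ 0ℤ
    Dif-vanishes j@(suc _) M<j
      rewrite k>n⇒nCk≡0 {ℓ ∸ j} {j} (ℕP.m<n+o⇒m∸n<o ℓ j (ℓ<2j j M<j)) | k>n⇒nCk≡0 {M} {j} M<j =
      cong (λ z → + 0 - z) (ℤP.*-zeroʳ ((+ 4) ^ j))

    ℓ∣[2M+1]* : ∀ x → + ℓ ℤ∣.∣ (+ 2 * + M + 1ℤ) * x
    ℓ∣[2M+1]* x = subst (λ z → + ℓ ℤ∣.∣ z * x) ℓ≡2M+1 (ℤ∣.∣m⇒∣m*n x ℤ∣.∣-refl)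

    ℓ∣Dif-upto : ∀ i → suc i ≤ M → + ℓ ℤ∣.∣ Dif (suc i)
    ℓ∣Dif-upto zero    _     = subst (+ ℓ ℤ∣.∣_) (sym Dif-1) (ℤ∣.divides 0ℤ refl)
    ℓ∣Dif-upto (suc i) i+2≤M =
      ∣c*x⇒∣x ℓ-prime (suc J) (Dif (suc J)) (s≤s z≤n) J+1<ℓ
        (∣c*x⇒∣x ℓ-prime J (+ suc J * Dif (suc J)) (s≤s z≤n) (ℕP.<-trans (ℕP.n<1+n J) J+1<ℓ)
          (ℤ∣.∣m+n∣n⇒∣m (Dif-recurrence J (s≤s z≤n) i+2≤M)
                        (ℤ∣.∣n⇒∣m*n (+ 2 * + J * (+ 2 * + J + 1ℤ)) (ℓ∣Dif-upto i (ℕP.<⇒≤ i+2≤M)))))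
      where
      J = suc i
      J+1<ℓ : suc J < ℓ
      J+1<ℓ = ℕP.≤-<-trans i+2≤M (s≤s (subst (M ≤_) (sym (double≡2* M)) (ℕP.m≤m+n M (M ℕ.+ 0))))

    ℓ∣Dif : ∀ j → + ℓ ℤ∣.∣ Dif (suc j)
    ℓ∣Dif j with suc j ℕ.≤? M
    ... | yes j<M = ℓ∣Dif-upto j j<M
    ... | no  j≮M = subst (+ ℓ ℤ∣.∣_) (sym (Dif-vanishes (suc j) (ℕP.≰⇒> j≮M))) (ℤ∣.divides 0ℤ refl)

    -- Since 2(M + 1) = ℓ + 1, the factor M + 1 acts as 1/2 modulo ℓ.
    ℓ∣closed-difference : ∀ j → + ℓ ℤ∣.∣ (- + 6) ^ j * + ((ℓ ∸ j) C j) - + suc M * (oneZ j + (- + 24) ^ j * + (M C j))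
    ℓ∣closed-difference zero    = ℤ∣.divides (- 1ℤ) (trans (constant (+ M)) (cong (- 1ℤ *_) (sym ℓ≡2M+1)))
      where constant : ∀ m → 1ℤ * 1ℤ - (1ℤ + m) * (1ℤ + 1ℤ * 1ℤ) ≡ - 1ℤ * (+ 2 * m + 1ℤ)
            constant = solve-∀
    ℓ∣closed-difference (suc j) = subst (+ ℓ ℤ∣.∣_) (sym factored) (ℤ∣.∣n⇒∣m*n ((- + 6) ^ suc j) ℓ∣X)
      where
      A = + ((ℓ ∸ suc j) C suc j)
      B = (+ 4) ^ suc j * + (M C suc j)
      X = A - + suc M * B
      factored : (- + 6) ^ suc j * A - + suc M * (+ 0 + (- + 24) ^ suc j * + (M C suc j)) ≡ (- + 6) ^ suc j * X
      factored = trans (cong (λ p → (- + 6) ^ suc j * A - + suc M * (+ 0 + p * + (M C suc j)))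
                             (^-distribʳ-* (- + 6) (+ 4) (suc j)))
                       (pull ((- + 6) ^ suc j) A (+ suc M) ((+ 4) ^ suc j) (+ (M C suc j)))
        where pull : ∀ p a m f c → p * a - m * (+ 0 + p * f * c) ≡ p * (a - m * (f * c))
              pull = solve-∀
      halve : ∀ m a b → a - (1ℤ + m) * b ≡ (1ℤ + m) * ((+ 2 * a - b) - (+ 2 * m + 1ℤ) * b) - (+ 2 * m + 1ℤ) * (a - (1ℤ + m) * b)
      halve = solve-∀
      ℓ∣X : + ℓ ℤ∣.∣ X
      ℓ∣X = subst (+ ℓ ℤ∣.∣_) (sym (halve (+ M) A B))
              (ℤ∣.∣m∣n⇒∣m-n (ℤ∣.∣n⇒∣m*n (1ℤ + + M) (ℤ∣.∣m∣n⇒∣m-n (ℓ∣Dif j) (ℓ∣[2M+1]* B))) (ℓ∣[2M+1]* X))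

    [ℓ+1]/2≡M+1 : (ℓ ℕ.+ 1) ℕ./ 2 ≡ suc M
    [ℓ+1]/2≡M+1 = trans (cong (ℕ._/ 2) (ℕP.+-comm ℓ 1)) (double/2 (suc M))

    U-RHS-closed : ∀ j → U (suc ℓ) j - RHS ℓ j
                         ≡ (- + 6) ^ j * + ((ℓ ∸ j) C j) - + suc M * (oneZ j + (- + 24) ^ j * + (M C j))
    U-RHS-closed j = cong₂ _-_ (U-closed ℓ j) (trans (RHS-closed ℓ j)
      (cong₂ (λ h m → + h * (oneZ j + (- + 24) ^ j * + (m C j))) [ℓ+1]/2≡M+1 (double/2 M)))

    ℓ∣U-RHS : ∀ j → + ℓ ℤ∣.∣ U (suc ℓ) j - RHS ℓ j
    ℓ∣U-RHS j = subst (+ ℓ ℤ∣.∣_) (sym (U-RHS-closed j)) (ℓ∣closed-difference j)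


open Lemmas
open import Defs
open import Data.Nat using (ℕ; suc; _≤_; _<_; _+_; _/_)
open import Data.Nat.Primality using (Prime)
open import Data.Integer using (ℤ; +_; _-_)
open import Data.Integer.Divisibility using (_∣_)
import Data.Rational
open import Data.Product using (_×_; ∃; _,_)
open import Relation.Binary.PropositionalEquality using (_≡_; refl; sym; subst)
import Data.Integer.Divisibility.Signed as ℤ∣
import Data.Nat.Properties as ℕP

corollary7p2 : ((k : ℕ) → 2 ≤ k → (j : ℕ) → ∃ λ (z : ℤ) → P k j ≡ z Data.Rational./ 1)
               × ((ℓ : ℕ) → Prime ℓ → 3 < ℓ → (j : ℕ) →
                    ∃ λ (z : ℤ) → P ((ℓ + 1) / 2) j ≡ z Data.Rational./ 1 × (+ ℓ) ∣ (z - RHS ℓ j))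
corollary7p2 = (λ k _ j → U (double k) j , P≡U k j) , congruence
  where
  congruence : (ℓ : ℕ) → Prime ℓ → 3 < ℓ → (j : ℕ) →
               ∃ λ (z : ℤ) → P ((ℓ + 1) / 2) j ≡ z Data.Rational./ 1 × (+ ℓ) ∣ (z - RHS ℓ j)
  congruence ℓ ℓ-prime 3<ℓ j with prime>2⇒odd ℓ ℓ-prime (ℕP.<-trans (ℕP.n<1+n 2) 3<ℓ)
  ... | M , refl = U (suc ℓ) j
                 , subst (λ k → P k j ≡ U (suc ℓ) j Data.Rational./ 1) (sym [ℓ+1]/2≡M+1) (P≡U (suc M) j)
                 , ℤ∣.∣⇒∣ᵤ (ℓ∣U-RHS j)
    where open Congruence M ℓ-prime using ([ℓ+1]/2≡M+1; ℓ∣U-RHS)
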